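{- Let $\Lambda$ be a symplectic lattice of type $(d_1,\dots,d_g)$ with $d_1=d_2=1$. A primitive vector $v\in\Lambda$ is splitting if and only if the element $[v^\ast]\in D_\Lambda$ is splitting. Consequently $v\mapsto[v^\ast]$ defines a bijection $$\{\, v\in\Lambda \mid v \text{ splitting}\,\}/\Gamma_\Lambda \longrightarrow \{\, x\in D_\Lambda \mid x \text{ splitting}\,\}.$$
   Context: A symplectic lattice is a free $\mathbb{Z}$-module $\Lambda$ of rank $2g$ with a nondegenerate alternating bilinear form $(\cdot,\cdot)\colon\Lambda\times\Lambda\to\mathbb{Z}$. Let $U$ be the rank-2 lattice with Gram matrix $\begin{pmatrix}0&1\\-1&0\end{pmatrix}$ and $U(d)$ its form scaled by $d$. Every symplectic lattice is isometric to $U(d_1)\oplus\cdots\oplus U(d_g)$ with $d_i\mid d_{i+1}$; $(d_1,\dots,d_g)$ is its type. $\Lambda^\vee=\{v\in\Lambda\otimes\mathbb{Q}\mid (v,\Lambda)\subset\mathbb{Z}\}$, $D_\Lambda=\Lambda^\vee/\Lambda$ with the induced nondegenerate form $D_\Lambda\times D_\Lambda\to\mathbb{Q}/\mathbb{Z}$. $\Gamma_\Lambda$ is the kernel of $\mathrm{Sp}(\Lambda)\to\mathrm{Sp}(D_\Lambda)$ (isometry groups). A vector $v$ is primitive if $\mathbb{Q}v\cap\Lambda=\mathbb{Z}v$; then $\mathrm{div}(v)>0$ is defined by $(v,\Lambda)=\mathrm{div}(v)\mathbb{Z}$, $v^\ast=v/\mathrm{div}(v)$, and $[v^\ast]$ is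 its class in $D_\Lambda$. A primitive $v\in\Lambda$ is splitting if it lies in a rank-2 sublattice $\Lambda_1$ with $\Lambda=\Lambda_1\oplus\Lambda_1^\perp$. An element $x\in D_\Lambda$ of order $d$ is splitting if there is $y\in D_\Lambda$ of order $d$ with $(x,y)=1/d\in\mathbb{Q}/\mathbb{Z}$ (equivalently, $x$ lies in a subgroup $D_1\cong(\mathbb{Z}/d)^{\oplus2}$ with $D_\Lambda=D_1\oplus D_1^\perp$). -}

module Defs where

open import Data.Nat as ℕ using (ℕ; zero; suc)
import Data.Nat.Divisibility as ℕD
open import Data.Integer using (ℤ; +_; _+_; _*_; _-_; -_)
open import Data.Integer.Divisibility using (_∣_)
open import Data.Fin using (Fin; toℕ)
open import Data.Vec using (Vec; []; _∷_; lookup; zipWith; map; replicate)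
open import Data.Product using (_×_; _,_; ∃; ∃-syntax; Σ-syntax)
open import Relation.Binary.PropositionalEquality using (_≡_)
open import Relation.Nullary using (¬_)

-- The model lattice  Λ = U(d_1) ⊕ … ⊕ U(d_g)  with basis e_1,f_1,…,e_g,f_g.
-- A vector is a length-g vector of coordinate pairs (a_i , b_i) = a_i e_i + b_i f_i.
L : ℕ → Set
L g = Vec (ℤ × ℤ) g

infixl 6 _⊕_ _⊖_
infixr 7 _·_

_⊕_ : ∀ {g} → L g → L g → L g
_⊕_ = zipWith (λ x y → (Data.Product.proj₁ x + Data.Product.proj₁ y , Data.Product.proj₂ x + Data.Product.proj₂ y))

_·_ : ∀ {g} → ℤ → L g → L g
k · u = map (λ x → (k * Data.Product.proj₁ x , k * Data.Product.proj₂ x)) u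

_⊖_ : ∀ {g} → L g → L g → L g
u ⊖ w = u ⊕ (- (+ 1)) · w

0L : ∀ {g} → L g
0L = replicate _ (+ 0 , + 0)

form : ∀ {g} → Vec ℕ g → L g → L g → ℤ
form [] [] [] = + 0
form (d ∷ ds) ((a , b) ∷ u) ((a' , b') ∷ w) = + d * (a * b' - b * a') + form ds u w

IsType : ∀ {g} → Vec ℕ g → Set
IsType {g} d = (∀ i → 1 ℕ.≤ lookup d i)
             × (∀ (i j : Fin g) → toℕ i ℕ.≤ toℕ j → lookup d i ℕD.∣ lookup d j)

-- Elements of Λ ⊗ ℚ represented as  w / n  with w ∈ Λ, n ∈ ℕ (n ≥ 1 required where relevant).
QV : ℕ → Set
QV g = L g × ℕ

module _ {g : ℕ} (d : Vec ℕ g) where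

  Primitive : L g → Set
  Primitive v = (¬ v ≡ 0L)
              × (∀ (w : L g) (p q : ℤ) → ¬ q ≡ + 0 → q · w ≡ p · v → ∃[ k ] w ≡ k · v)

  IsDiv : L g → ℕ → Set
  IsDiv v m = (1 ℕ.≤ m) × (∀ w → + m ∣ form d v w) × (∃[ w ] form d v w ≡ + m)

  InDual : QV g → Set
  InDual (w , n) = (1 ℕ.≤ n) × (∀ u → + n ∣ form d w u)

  InL : QV g → Set
  InL (w , n) = ∃[ u ] w ≡ (+ n) · u

  -- equality in D_Λ = Λ^∨ / Λ :  w/n - w'/n' ∈ Λ
  _≈D_ : QV g → QV g → Set
  (w , n) ≈D (w' , n') = ∃[ u ] ((+ n') · w ⊖ (+ n) · w' ≡ (+ n * + n') · u)

  _·D_ : ℕ → QV g → QV g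
  k ·D (w , n) = ((+ k) · w , n)

  HasOrder : QV g → ℕ → Set
  HasOrder x k = (1 ℕ.≤ k) × InL (k ·D x)
               × (∀ k' → 1 ℕ.≤ k' → InL (k' ·D x) → k ℕ.≤ k')

  -- the induced pairing ([w/n] , [w'/n']) = (w,w')/(n n') equals 1/k in ℚ/ℤ
  PairingIsInv : QV g → QV g → ℕ → Set
  PairingIsInv (w , n) (w' , n') k =
    + (k ℕ.* n ℕ.* n') ∣ (+ k * form d w w' - + (n ℕ.* n'))

  SplittingD : QV g → Set
  SplittingD x = ∃[ k ] (HasOrder x k × ∃[ y ] (InDual y × HasOrder y k × PairingIsInv x y k))

  Indep : L g → L g → Set
  Indep a b = ∀ p q → p · a ⊕ q · b ≡ 0L → (p ≡ + 0) × (q ≡ + 0)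

  -- splitting vector: primitive v lying in a rank-2 sublattice Λ₁ = ℤa ⊕ ℤb with
  -- Λ = Λ₁ ⊕ Λ₁^⊥ (every u is (element of Λ₁) + (element of Λ₁^⊥), and Λ₁ ∩ Λ₁^⊥ = 0)
  Splitting : L g → Set
  Splitting v = Primitive v
    × Σ[ a ∈ L g ] Σ[ b ∈ L g ]
        ( Indep a b
        × (∃[ p ] ∃[ q ] v ≡ p · a ⊕ q · b)
        × (∀ u → ∃[ p ] ∃[ q ] ( (form d (u ⊖ (p · a ⊕ q · b)) a ≡ + 0)
                               × (form d (u ⊖ (p · a ⊕ q · b)) b ≡ + 0)))
        × (∀ p q → form d (p · a ⊕ q · b) a ≡ + 0 → form d (p · a ⊕ q · b) b ≡ + 0
                 → p · a ⊕ q · b ≡ 0L))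

  -- γ ∈ Γ_Λ: a bijective additive map preserving the form (γ ∈ Sp(Λ)) whose
  -- ℚ-linear extension γ(w/n) = γ(w)/n acts trivially on D_Λ.
  InΓ : (L g → L g) → Set
  InΓ γ = (∀ u w → γ (u ⊕ w) ≡ γ u ⊕ γ w)
        × (Σ[ δ ∈ (L g → L g) ] ((∀ u → δ (γ u) ≡ u) × (∀ u → γ (δ u) ≡ u)))
        × (∀ u w → form d (γ u) (γ w) ≡ form d u w)
        × (∀ (w : L g) (n : ℕ) → InDual (w , n) → (γ w , n) ≈D (w , n))

{-# OPTIONS --safe #-}
module Submission where

-- A primitive v with div v = m is splitting iff it has a partner a with (v , a) = m and m ∣ (a , ·):
-- then v and a span a copy of U(m) split off from Λ, and [v/m], [a/m] ∈ D_Λ have order m and pair to 1/m.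
-- Conversely, a splitting x = [u/k] with partner [u′/k] gives (u , u′) ≡ k mod k², and correcting u′ by a
-- multiple of some z with (u , z) = k yields a partner of u; when d₁ = 1, the unimodular pair e₁ , f₁ lets
-- one first change u within its class so that (u , f₁) = k. Elements of Γ_Λ transport partners and fix
-- [v/m]. For injectivity, an SL₂(ℤ)-move on ⟨e₁ , f₁⟩ followed by an Eichler transvection brings v and w
-- to the normal form (e₁ , ·) = m; then w = v + m Z with Z ⊥ e₁, and one more Eichler transvection maps
-- v to w.

open import Defs
open import Data.Nat as ℕ using (ℕ; zero; suc)
import Data.Nat.Properties as ℕP
import Data.Nat.Divisibility as ℕD
open import Data.Nat.GCD using (module Bézout; module GCD)
open import Data.Integer as ℤ using (ℤ; +_; -[1+_]; -1ℤ; _+_; _*_; _-_; -_)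
import Data.Integer.Properties as ℤP
open import Data.Integer.Divisibility using () renaming (_∣_ to _∣ᵤ_)
open import Data.Integer.Divisibility.Signed
  using (_∣_; divides; ∣ᵤ⇒∣; ∣⇒∣ᵤ; ∣-refl; ∣m⇒∣-m; ∣n⇒∣m*n; ∣m⇒∣m*n; ∣m∣n⇒∣m+n; *-monoˡ-∣; *-monoʳ-∣; *-cancelʳ-∣)
open import Data.Integer.Tactic.RingSolver using (solve-∀)
open import Data.Fin using (zero; suc)
open import Data.Vec using (Vec; []; _∷_; lookup)
open import Data.Vec.Properties using (∷-injectiveˡ; ∷-injectiveʳ)
open import Data.Product using (_×_; _,_; proj₁; proj₂; ∃-syntax)
open import Data.Product.Properties using (,-injectiveˡ; ,-injectiveʳ)
open import Data.Empty using (⊥-elim)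
open import Relation.Binary.PropositionalEquality
open import Relation.Nullary using (yes; no)
open import Algebra.Properties.AbelianGroup ℤP.+-0-abelianGroup using (∙-cancelˡ; ∙-cancelʳ)

pos≢0 : ∀ {m} → 1 ℕ.≤ m → + m ≢ + 0
pos≢0 (ℕ.s≤s _) ()

-- L g as a ℤ-module, and the alternating form

⊕-identityˡ : ∀ {g} (u : L g) → 0L ⊕ u ≡ u
⊕-identityˡ [] = refl
⊕-identityˡ ((a , b) ∷ u) = cong₂ _∷_ (cong₂ _,_ (ℤP.+-identityˡ a) (ℤP.+-identityˡ b)) (⊕-identityˡ u)

⊕-identityʳ : ∀ {g} (u : L g) → u ⊕ 0L ≡ u
⊕-identityʳ [] = refl
⊕-identityʳ ((a , b) ∷ u) = cong₂ _∷_ (cong₂ _,_ (ℤP.+-identityʳ a) (ℤP.+-identityʳ b)) (⊕-identityʳ u)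

⊕-cancelʳ : ∀ {g} (u w t : L g) → u ⊕ t ≡ w ⊕ t → u ≡ w
⊕-cancelʳ [] [] [] _ = refl
⊕-cancelʳ ((a , b) ∷ u) ((a′ , b′) ∷ w) ((x , y) ∷ t) eq =
  cong₂ _∷_ (cong₂ _,_ (∙-cancelʳ x a a′ (,-injectiveˡ head)) (∙-cancelʳ y b b′ (,-injectiveʳ head)))
            (⊕-cancelʳ u w t (∷-injectiveʳ eq))
  where
  head : (a + x , b + y) ≡ (a′ + x , b′ + y)
  head = ∷-injectiveˡ eq

·-distribˡ : ∀ {g} k (u w : L g) → k · (u ⊕ w) ≡ k · u ⊕ k · w
·-distribˡ k [] [] = refl
·-distribˡ k ((a , b) ∷ u) ((a′ , b′) ∷ w) =
  cong₂ _∷_ (cong₂ _,_ (ℤP.*-distribˡ-+ k a a′) (ℤP.*-distribˡ-+ k b b′)) (·-distribˡ k u w)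

·-distribʳ : ∀ {g} k l (u : L g) → (k + l) · u ≡ k · u ⊕ l · u
·-distribʳ k l [] = refl
·-distribʳ k l ((a , b) ∷ u) =
  cong₂ _∷_ (cong₂ _,_ (ℤP.*-distribʳ-+ a k l) (ℤP.*-distribʳ-+ b k l)) (·-distribʳ k l u)

·-assoc : ∀ {g} k l (u : L g) → (k * l) · u ≡ k · (l · u)
·-assoc k l [] = refl
·-assoc k l ((a , b) ∷ u) = cong₂ _∷_ (cong₂ _,_ (ℤP.*-assoc k l a) (ℤP.*-assoc k l b)) (·-assoc k l u)

·-identityˡ : ∀ {g} (u : L g) → + 1 · u ≡ u
·-identityˡ [] = refl
·-identityˡ ((a , b) ∷ u) = cong₂ _∷_ (cong₂ _,_ (ℤP.*-identityˡ a) (ℤP.*-identityˡ b)) (·-identityˡ u)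

·-zeroˡ : ∀ {g} (u : L g) → + 0 · u ≡ 0L
·-zeroˡ [] = refl
·-zeroˡ ((a , b) ∷ u) = cong₂ _∷_ refl (·-zeroˡ u)

·-zeroʳ : ∀ {g} k → k · 0L ≡ 0L {g}
·-zeroʳ {zero} k = refl
·-zeroʳ {suc g} k = cong₂ _∷_ (cong₂ _,_ (ℤP.*-zeroʳ k) (ℤP.*-zeroʳ k)) (·-zeroʳ k)

·-cancelˡ : ∀ {g} k .{{_ : ℤ.NonZero k}} {u w : L g} → k · u ≡ k · w → u ≡ w
·-cancelˡ k {[]} {[]} _ = refl
·-cancelˡ k {(a , b) ∷ u} {(a′ , b′) ∷ w} eq =
  cong₂ _∷_ (cong₂ _,_ (ℤP.*-cancelˡ-≡ k a a′ (,-injectiveˡ head)) (ℤP.*-cancelˡ-≡ k b b′ (,-injectiveʳ head)))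
            (·-cancelˡ k (∷-injectiveʳ eq))
  where
  head : (k * a , k * b) ≡ (k * a′ , k * b′)
  head = ∷-injectiveˡ eq

·-cancelʳ : ∀ {g} {k l} (u : L g) → u ≢ 0L → k · u ≡ l · u → k ≡ l
·-cancelʳ [] u≢0 _ = ⊥-elim (u≢0 refl)
·-cancelʳ {k = k} {l} ((a , b) ∷ u) u≢0 eq with a ℤ.≟ + 0 | b ℤ.≟ + 0
... | no a≢0 | _ = ℤP.*-cancelʳ-≡ k l a {{ℤ.≢-nonZero a≢0}} (,-injectiveˡ (∷-injectiveˡ eq))
... | yes _ | no b≢0 = ℤP.*-cancelʳ-≡ k l b {{ℤ.≢-nonZero b≢0}} (,-injectiveʳ (∷-injectiveˡ eq))
... | yes refl | yes refl = ·-cancelʳ u (λ u≡0 → u≢0 (cong ((+ 0 , + 0) ∷_) u≡0)) (∷-injectiveʳ eq)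

scale-shift : ∀ {g} k l (u s : L g) → k · (u ⊕ l · s) ⊖ k · u ≡ (l * k) · s
scale-shift k l [] [] = refl
scale-shift k l ((a , b) ∷ u) ((x , y) ∷ s) = cong₂ _∷_ (cong₂ _,_ (expand k l a x) (expand k l b y)) (scale-shift k l u s)
  where
  expand : ∀ k l a x → k * (a + l * x) + - + 1 * (k * a) ≡ (l * k) * x
  expand = solve-∀

⊖-swap : ∀ {g} (u w : L g) → u ⊖ w ≡ -1ℤ · (w ⊖ u)
⊖-swap [] [] = refl
⊖-swap ((a , b) ∷ u) ((x , y) ∷ w) = cong₂ _∷_ (cong₂ _,_ (expand a x) (expand b y)) (⊖-swap u w)
  where
  expand : ∀ a x → a + - + 1 * x ≡ - + 1 * (x + - + 1 * a)
  expand = solve-∀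

⊖-telescope : ∀ {g} (u w t : L g) → u ⊖ t ≡ (u ⊖ w) ⊕ (w ⊖ t)
⊖-telescope [] [] [] = refl
⊖-telescope ((a , b) ∷ u) ((x , y) ∷ w) ((r , s) ∷ t) =
  cong₂ _∷_ (cong₂ _,_ (expand a x r) (expand b y s)) (⊖-telescope u w t)
  where
  expand : ∀ a x r → a + - + 1 * r ≡ (a + - + 1 * x) + (x + - + 1 * r)
  expand = solve-∀

⊕-⊖-cancel : ∀ {g} (u w : L g) → w ⊕ (u ⊖ w) ≡ u
⊕-⊖-cancel [] [] = refl
⊕-⊖-cancel ((a , b) ∷ u) ((x , y) ∷ w) = cong₂ _∷_ (cong₂ _,_ (expand a x) (expand b y)) (⊕-⊖-cancel u w)
  where
  expand : ∀ a x → x + (a + - + 1 * x) ≡ a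
  expand = solve-∀

⊕-·-interchange : ∀ {g} (u w y x : L g) s s′ r r′ →
  (u ⊕ w) ⊕ (s + s′) · y ⊕ (r + r′) · x ≡ (u ⊕ s · y ⊕ r · x) ⊕ (w ⊕ s′ · y ⊕ r′ · x)
⊕-·-interchange [] [] [] [] s s′ r r′ = refl
⊕-·-interchange ((a , b) ∷ u) ((a′ , b′) ∷ w) ((y₁ , y₂) ∷ y) ((x₁ , x₂) ∷ x) s s′ r r′ =
  cong₂ _∷_ (cong₂ _,_ (expand a a′ y₁ x₁ s s′ r r′) (expand b b′ y₂ x₂ s s′ r r′)) (⊕-·-interchange u w y x s s′ r r′)
  where
  expand : ∀ a a′ y x s s′ r r′ → (a + a′) + (s + s′) * y + (r + r′) * x ≡ (a + s * y + r * x) + (a′ + s′ * y + r′ * x)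
  expand = solve-∀

shear-cancel : ∀ {g} (u y x : L g) s r → (u ⊕ s · y ⊕ r · x) ⊕ s · (-1ℤ · y) ⊕ (- r) · x ≡ u
shear-cancel [] [] [] s r = refl
shear-cancel ((a , b) ∷ u) ((y₁ , y₂) ∷ y) ((x₁ , x₂) ∷ x) s r =
  cong₂ _∷_ (cong₂ _,_ (expand a y₁ x₁ s r) (expand b y₂ x₂ s r)) (shear-cancel u y x s r)
  where
  expand : ∀ a y x s r → (a + s * y + r * x) + s * (- + 1 * y) + (- r) * x ≡ a
  expand = solve-∀

shear-factor : ∀ {g} (u y x : L g) a b c k → u ⊕ (a * k) · y ⊕ (b * k + c * (a * k)) · x ≡ u ⊕ k · (a · y ⊕ (b + c * a) · x)
shear-factor [] [] [] a b c k = refl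
shear-factor ((u₁ , u₂) ∷ u) ((y₁ , y₂) ∷ y) ((x₁ , x₂) ∷ x) a b c k =
  cong₂ _∷_ (cong₂ _,_ (expand u₁ y₁ x₁ a b c k) (expand u₂ y₂ x₂ a b c k)) (shear-factor u y x a b c k)
  where
  expand : ∀ u y x a b c k → u + (a * k) * y + (b * k + c * (a * k)) * x ≡ u + k * (a * y + (b + c * a) * x)
  expand = solve-∀

module _ {g : ℕ} (γ : L g → L g) (additive : ∀ u w → γ (u ⊕ w) ≡ γ u ⊕ γ w) where
  open ≡-Reasoning

  additive⇒zero : γ 0L ≡ 0L
  additive⇒zero = ⊕-cancelʳ (γ 0L) 0L (γ 0L) (begin
    γ 0L ⊕ γ 0L     ≡⟨ additive 0L 0L ⟨
    γ (0L ⊕ 0L)     ≡⟨ cong γ (⊕-identityʳ 0L) ⟩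
    γ 0L            ≡⟨ ⊕-identityˡ (γ 0L) ⟨
    0L ⊕ γ 0L       ∎)

  additive⇒linear : ∀ k u → γ (k · u) ≡ k · γ u
  additive⇒linear (+ n) u = natural n
    where
    natural : ∀ n → γ (+ n · u) ≡ + n · γ u
    natural zero = begin
      γ (+ 0 · u)     ≡⟨ cong γ (·-zeroˡ u) ⟩
      γ 0L            ≡⟨ additive⇒zero ⟩
      0L              ≡⟨ ·-zeroˡ (γ u) ⟨
      + 0 · γ u       ∎
    natural (suc n) = begin
      γ (+ suc n · u)          ≡⟨ cong γ (·-distribʳ (+ 1) (+ n) u) ⟩
      γ (+ 1 · u ⊕ + n · u)    ≡⟨ additive _ _ ⟩
      γ (+ 1 · u) ⊕ γ (+ n · u) ≡⟨ cong₂ _⊕_ (cong γ (·-identityˡ u)) (natural n) ⟩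
      γ u ⊕ + n · γ u          ≡⟨ cong (_⊕ + n · γ u) (·-identityˡ (γ u)) ⟨
      + 1 · γ u ⊕ + n · γ u    ≡⟨ ·-distribʳ (+ 1) (+ n) (γ u) ⟨
      + suc n · γ u            ∎
  additive⇒linear -[1+ n ] u = ⊕-cancelʳ _ _ (γ (+ suc n · u)) (begin
    γ (-[1+ n ] · u) ⊕ γ (+ suc n · u)     ≡⟨ additive _ _ ⟨
    γ (-[1+ n ] · u ⊕ + suc n · u)         ≡⟨ cong γ (cancel u) ⟩
    γ 0L                                   ≡⟨ additive⇒zero ⟩
    0L                                     ≡⟨ cancel (γ u) ⟨
    -[1+ n ] · γ u ⊕ + suc n · γ u         ≡⟨ cong (-[1+ n ] · γ u ⊕_) (additive⇒linear (+ suc n) u) ⟨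
    -[1+ n ] · γ u ⊕ γ (+ suc n · u)       ∎)
    where
    cancel : ∀ t → -[1+ n ] · t ⊕ + suc n · t ≡ 0L
    cancel t = trans (sym (·-distribʳ -[1+ n ] (+ suc n) t)) (trans (cong (_· t) (ℤP.+-inverseˡ (+ suc n))) (·-zeroˡ t))

form-⊕ˡ : ∀ {g} (d : Vec ℕ g) (u w t : L g) → form d (u ⊕ w) t ≡ form d u t + form d w t
form-⊕ˡ [] [] [] [] = refl
form-⊕ˡ (c ∷ d) ((a , b) ∷ u) ((a′ , b′) ∷ w) ((x , y) ∷ t) =
  trans (cong (λ z → + c * ((a + a′) * y - (b + b′) * x) + z) (form-⊕ˡ d u w t))
        (expand (+ c) a b a′ b′ x y (form d u t) (form d w t))
  where
  expand : ∀ c a b a′ b′ x y P Q →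
    c * ((a + a′) * y - (b + b′) * x) + (P + Q) ≡ (c * (a * y - b * x) + P) + (c * (a′ * y - b′ * x) + Q)
  expand = solve-∀

form-·ˡ : ∀ {g} (d : Vec ℕ g) k (u t : L g) → form d (k · u) t ≡ k * form d u t
form-·ˡ [] k [] [] = sym (ℤP.*-zeroʳ k)
form-·ˡ (c ∷ d) k ((a , b) ∷ u) ((x , y) ∷ t) =
  trans (cong (λ z → + c * ((k * a) * y - (k * b) * x) + z) (form-·ˡ d k u t)) (expand (+ c) k a b x y (form d u t))
  where
  expand : ∀ c k a b x y P → c * ((k * a) * y - (k * b) * x) + k * P ≡ k * (c * (a * y - b * x) + P)
  expand = solve-∀

form-antisym : ∀ {g} (d : Vec ℕ g) (u t : L g) → form d u t ≡ - form d t u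
form-antisym [] [] [] = refl
form-antisym (c ∷ d) ((a , b) ∷ u) ((x , y) ∷ t) =
  trans (cong (λ z → + c * (a * y - b * x) + z) (form-antisym d u t)) (expand (+ c) a b x y (form d t u))
  where
  expand : ∀ c a b x y P → c * (a * y - b * x) + - P ≡ - (c * (x * b - y * a) + P)
  expand = solve-∀

form-self : ∀ {g} (d : Vec ℕ g) (u : L g) → form d u u ≡ + 0
form-self [] [] = refl
form-self (c ∷ d) ((a , b) ∷ u) =
  trans (cong (λ z → + c * (a * b - b * a) + z) (form-self d u)) (expand (+ c) a b)
  where
  expand : ∀ c a b → c * (a * b - b * a) + + 0 ≡ + 0
  expand = solve-∀

form-0ˡ : ∀ {g} (d : Vec ℕ g) (u : L g) → form d 0L u ≡ + 0
form-0ˡ d u = trans (cong (λ z → form d z u) (sym (·-zeroˡ u))) (form-·ˡ d (+ 0) u u)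

module Lattice {g : ℕ} (d : Vec ℕ g) where
  open ≡-Reasoning

  ⟪_,_⟫ : L g → L g → ℤ
  ⟪ u , w ⟫ = form d u w

  form-⊕ʳ : ∀ t u w → ⟪ t , u ⊕ w ⟫ ≡ ⟪ t , u ⟫ + ⟪ t , w ⟫
  form-⊕ʳ t u w = begin
    ⟪ t , u ⊕ w ⟫               ≡⟨ form-antisym d t (u ⊕ w) ⟩
    - ⟪ u ⊕ w , t ⟫             ≡⟨ cong -_ (form-⊕ˡ d u w t) ⟩
    - (⟪ u , t ⟫ + ⟪ w , t ⟫)   ≡⟨ ℤP.neg-distrib-+ ⟪ u , t ⟫ ⟪ w , t ⟫ ⟩
    - ⟪ u , t ⟫ + - ⟪ w , t ⟫   ≡⟨ cong₂ _+_ (form-antisym d t u) (form-antisym d t w) ⟨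
    ⟪ t , u ⟫ + ⟪ t , w ⟫       ∎

  form-·ʳ : ∀ t k u → ⟪ t , k · u ⟫ ≡ k * ⟪ t , u ⟫
  form-·ʳ t k u = begin
    ⟪ t , k · u ⟫        ≡⟨ form-antisym d t (k · u) ⟩
    - ⟪ k · u , t ⟫      ≡⟨ cong -_ (form-·ˡ d k u t) ⟩
    - (k * ⟪ u , t ⟫)    ≡⟨ ℤP.neg-distribʳ-* k ⟪ u , t ⟫ ⟩
    k * - ⟪ u , t ⟫      ≡⟨ cong (k *_) (form-antisym d t u) ⟨
    k * ⟪ t , u ⟫        ∎

  form-span : ∀ p a q b t → ⟪ p · a ⊕ q · b , t ⟫ ≡ p * ⟪ a , t ⟫ + q * ⟪ b , t ⟫
  form-span p a q b t = trans (form-⊕ˡ d (p · a) (q · b) t) (cong₂ _+_ (form-·ˡ d p a t) (form-·ˡ d q b t))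

  form-scale : ∀ k l u w → ⟪ k · u , l · w ⟫ ≡ k * (l * ⟪ u , w ⟫)
  form-scale k l u w = trans (form-·ˡ d k u (l · w)) (cong (k *_) (form-·ʳ u l w))

  form-⊖ˡ : ∀ u w t → ⟪ u ⊖ w , t ⟫ ≡ ⟪ u , t ⟫ - ⟪ w , t ⟫
  form-⊖ˡ u w t = trans (form-⊕ˡ d u (-1ℤ · w) t)
                        (cong (λ z → ⟪ u , t ⟫ + z) (trans (form-·ˡ d -1ℤ w t) (ℤP.-1*i≡-i ⟪ w , t ⟫)))

  orthogonal-sym : ∀ {u t} → ⟪ u , t ⟫ ≡ + 0 → ⟪ t , u ⟫ ≡ + 0
  orthogonal-sym {u} {t} ut≡0 = trans (form-antisym d t u) (cong -_ ut≡0)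

  span-orthogonal : ∀ p a q b r → ⟪ r , a ⟫ ≡ + 0 → ⟪ r , b ⟫ ≡ + 0 → ⟪ p · a ⊕ q · b , r ⟫ ≡ + 0
  span-orthogonal p a q b r ra≡0 rb≡0 = begin
    ⟪ p · a ⊕ q · b , r ⟫          ≡⟨ form-span p a q b r ⟩
    p * ⟪ a , r ⟫ + q * ⟪ b , r ⟫  ≡⟨ cong₂ (λ x y → p * x + q * y) (orthogonal-sym ra≡0) (orthogonal-sym rb≡0) ⟩
    p * + 0 + q * + 0              ≡⟨ cong₂ _+_ (ℤP.*-zeroʳ p) (ℤP.*-zeroʳ q) ⟩
    + 0                            ∎

  hyperbolic-gram : ∀ a b p q p′ q′ → ⟪ p · a ⊕ q · b , p′ · a ⊕ q′ · b ⟫ ≡ (p * q′ - q * p′) * ⟪ a , b ⟫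
  hyperbolic-gram a b p q p′ q′ = begin
    ⟪ p · a ⊕ q · b , p′ · a ⊕ q′ · b ⟫
      ≡⟨ form-span p a q b _ ⟩
    p * ⟪ a , p′ · a ⊕ q′ · b ⟫ + q * ⟪ b , p′ · a ⊕ q′ · b ⟫
      ≡⟨ cong₂ (λ x y → p * x + q * y) (form-antisym d a _) (form-antisym d b _) ⟩
    p * - ⟪ p′ · a ⊕ q′ · b , a ⟫ + q * - ⟪ p′ · a ⊕ q′ · b , b ⟫
      ≡⟨ cong₂ (λ x y → p * - x + q * - y) (form-span p′ a q′ b a) (form-span p′ a q′ b b) ⟩
    p * - (p′ * ⟪ a , a ⟫ + q′ * ⟪ b , a ⟫) + q * - (p′ * ⟪ a , b ⟫ + q′ * ⟪ b , b ⟫)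
      ≡⟨ cong₂ (λ x y → p * - (p′ * x + q′ * ⟪ b , a ⟫) + q * - (p′ * ⟪ a , b ⟫ + q′ * y)) (form-self d a) (form-self d b) ⟩
    p * - (p′ * + 0 + q′ * ⟪ b , a ⟫) + q * - (p′ * ⟪ a , b ⟫ + q′ * + 0)
      ≡⟨ cong (λ x → p * - (p′ * + 0 + q′ * x) + q * - (p′ * ⟪ a , b ⟫ + q′ * + 0)) (form-antisym d b a) ⟩
    p * - (p′ * + 0 + q′ * - ⟪ a , b ⟫) + q * - (p′ * ⟪ a , b ⟫ + q′ * + 0)
      ≡⟨ expand p q p′ q′ ⟪ a , b ⟫ ⟩
    (p * q′ - q * p′) * ⟪ a , b ⟫ ∎
    where
    expand : ∀ p q p′ q′ e → p * - (p′ * + 0 + q′ * - e) + q * - (p′ * e + q′ * + 0) ≡ (p * q′ - q * p′) * e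
    expand = solve-∀

  -- Primitive vectors and split hyperbolic pairs

  primitive-∣ : ∀ {v w p q} → Primitive d v → q ≢ + 0 → q · w ≡ p · v → q ∣ p
  primitive-∣ {v} {w} {p} {q} (v≢0 , multiple) q≢0 qw≡pv with multiple w p q q≢0 qw≡pv
  ... | j , w≡jv = divides j (·-cancelʳ v v≢0 (begin
    p · v         ≡⟨ qw≡pv ⟨
    q · w         ≡⟨ cong (q ·_) w≡jv ⟩
    q · (j · v)   ≡⟨ ·-assoc q j v ⟨
    (q * j) · v   ≡⟨ cong (_· v) (ℤP.*-comm q j) ⟩
    (j * q) · v   ∎))

  primitive-order : ∀ {v m} → Primitive d v → 1 ℕ.≤ m → HasOrder d (v , m) m
  primitive-order {v} {m} prim m≥1 = m≥1 , (v , refl) , minimal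
    where
    minimal : ∀ k → 1 ℕ.≤ k → ∃[ u ] (+ k) · v ≡ (+ m) · u → m ℕ.≤ k
    minimal (suc k) _ (u , kv≡mu) = ℕD.∣⇒≤ (∣⇒∣ᵤ (primitive-∣ {p = + suc k} {q = + m} prim (pos≢0 m≥1) (sym kv≡mu)))

  order-unique : ∀ {x k k′} → HasOrder d x k → HasOrder d x k′ → k ≡ k′
  order-unique (k≥1 , kx∈L , k-min) (k′≥1 , k′x∈L , k′-min) = ℕP.≤-antisym (k-min _ k′≥1 k′x∈L) (k′-min _ k≥1 kx∈L)

  primitive-span-coprime : ∀ {a b p q δ} → Primitive d (p · a ⊕ q · b) → δ ∣ p → δ ∣ q → δ ∣ + 1
  primitive-span-coprime {a} {b} {δ = δ} prim@(v≢0 , _) (divides p′ refl) (divides q′ refl) =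
    primitive-∣ {w = p′ · a ⊕ q′ · b} {p = + 1} {q = δ} prim δ≢0 (begin
      δ · (p′ · a ⊕ q′ · b)              ≡⟨ ·-distribˡ δ (p′ · a) (q′ · b) ⟩
      δ · (p′ · a) ⊕ δ · (q′ · b)        ≡⟨ cong₂ _⊕_ (·-assoc δ p′ a) (·-assoc δ q′ b) ⟨
      (δ * p′) · a ⊕ (δ * q′) · b        ≡⟨ cong₂ (λ x y → x · a ⊕ y · b) (ℤP.*-comm δ p′) (ℤP.*-comm δ q′) ⟩
      (p′ * δ) · a ⊕ (q′ * δ) · b        ≡⟨ ·-identityˡ _ ⟨
      + 1 · ((p′ * δ) · a ⊕ (q′ * δ) · b) ∎)
    where
    δ≢0 : δ ≢ + 0
    δ≢0 refl = v≢0 (begin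
      (p′ * + 0) · a ⊕ (q′ * + 0) · b    ≡⟨ cong₂ (λ x y → x · a ⊕ y · b) (ℤP.*-zeroʳ p′) (ℤP.*-zeroʳ q′) ⟩
      + 0 · a ⊕ + 0 · b                  ≡⟨ cong₂ _⊕_ (·-zeroˡ a) (·-zeroˡ b) ⟩
      0L ⊕ 0L                            ≡⟨ ⊕-identityʳ 0L ⟩
      0L                                 ∎)

  -- v and a span a copy of U(m) that is an orthogonal summand of Λ.
  record SplitPair (v a : L g) (m : ℕ) : Set where
    field
      m≥1     : 1 ℕ.≤ m
      pairing : ⟪ v , a ⟫ ≡ + m
      v-div   : ∀ u → + m ∣ ⟪ v , u ⟫
      a-div   : ∀ u → + m ∣ ⟪ a , u ⟫

  module _ {v a : L g} {m : ℕ} (sp : SplitPair v a m) where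
    open SplitPair sp

    private
      instance
        m-nonZero : ℤ.NonZero (+ m)
        m-nonZero = ℕ.>-nonZero m≥1

    splitPair⇒primitive : Primitive d v
    splitPair⇒primitive = v≢0 , multiple
      where
      v≢0 : v ≢ 0L
      v≢0 v≡0 = pos≢0 m≥1 (begin
        + m            ≡⟨ pairing ⟨
        ⟪ v , a ⟫      ≡⟨ cong (λ x → ⟪ x , a ⟫) v≡0 ⟩
        ⟪ 0L , a ⟫     ≡⟨ form-0ˡ d a ⟩
        + 0            ∎)

      multiple : ∀ w p q → q ≢ + 0 → q · w ≡ p · v → ∃[ k ] w ≡ k · v
      multiple w p q q≢0 qw≡pv with a-div w
      ... | divides t aw≡tm = - t , ·-cancelˡ q {{ℤ.≢-nonZero q≢0}} (begin
        q · w            ≡⟨ qw≡pv ⟩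
        p · v            ≡⟨ cong (_· v) p≡q*-t ⟩
        (q * - t) · v    ≡⟨ ·-assoc q (- t) v ⟩
        q · (- t · v)    ∎)
        where
        p≡q*-t : p ≡ q * - t
        p≡q*-t = ℤP.*-cancelʳ-≡ p (q * - t) (+ m) (begin
          p * + m            ≡⟨ cong (p *_) pairing ⟨
          p * ⟪ v , a ⟫      ≡⟨ form-·ˡ d p v a ⟨
          ⟪ p · v , a ⟫      ≡⟨ cong (λ x → ⟪ x , a ⟫) qw≡pv ⟨
          ⟪ q · w , a ⟫      ≡⟨ form-·ˡ d q w a ⟩
          q * ⟪ w , a ⟫      ≡⟨ cong (q *_) (trans (form-antisym d w a) (cong -_ aw≡tm)) ⟩
          q * - (t * + m)    ≡⟨ cong (q *_) (ℤP.neg-distribˡ-* t (+ m)) ⟩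
          q * (- t * + m)    ≡⟨ ℤP.*-assoc q (- t) (+ m) ⟨
          q * - t * + m      ∎)

    splitPair-swap : SplitPair a (-1ℤ · v) m
    splitPair-swap = record
      { m≥1 = m≥1
      ; pairing = begin
          ⟪ a , -1ℤ · v ⟫    ≡⟨ form-·ʳ a -1ℤ v ⟩
          -1ℤ * ⟪ a , v ⟫    ≡⟨ ℤP.-1*i≡-i ⟪ a , v ⟫ ⟩
          - ⟪ a , v ⟫        ≡⟨ cong -_ (form-antisym d a v) ⟩
          - - ⟪ v , a ⟫      ≡⟨ ℤP.neg-involutive ⟪ v , a ⟫ ⟩
          ⟪ v , a ⟫          ≡⟨ pairing ⟩
          + m                ∎
      ; v-div = a-div
      ; a-div = λ u → subst (+ m ∣_) (sym (form-·ˡ d -1ℤ v u)) (∣n⇒∣m*n -1ℤ (v-div u))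
      }

    splitPair⇒isDiv : IsDiv d v m
    splitPair⇒isDiv = m≥1 , (λ u → ∣⇒∣ᵤ (v-div u)) , a , pairing

    private
      pairing-with-v : ∀ p q → ⟪ p · v ⊕ q · a , v ⟫ ≡ - (q * + m)
      pairing-with-v p q = begin
        ⟪ p · v ⊕ q · a , v ⟫            ≡⟨ form-span p v q a v ⟩
        p * ⟪ v , v ⟫ + q * ⟪ a , v ⟫    ≡⟨ cong₂ (λ x y → p * x + q * y) (form-self d v) (trans (form-antisym d a v) (cong -_ pairing)) ⟩
        p * + 0 + q * - + m              ≡⟨ expand p q (+ m) ⟩
        - (q * + m)                      ∎
        where
        expand : ∀ p q m → p * + 0 + q * - m ≡ - (q * m)
        expand = solve-∀

      pairing-with-a : ∀ p q → ⟪ p · v ⊕ q · a , a ⟫ ≡ p * + m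
      pairing-with-a p q = begin
        ⟪ p · v ⊕ q · a , a ⟫            ≡⟨ form-span p v q a a ⟩
        p * ⟪ v , a ⟫ + q * ⟪ a , a ⟫    ≡⟨ cong₂ (λ x y → p * x + q * y) pairing (form-self d a) ⟩
        p * + m + q * + 0                ≡⟨ expand p q (+ m) ⟩
        p * + m                          ∎
        where
        expand : ∀ p q m → p * m + q * + 0 ≡ p * m
        expand = solve-∀

      orthogonal⇒trivial : ∀ p q → ⟪ p · v ⊕ q · a , v ⟫ ≡ + 0 → ⟪ p · v ⊕ q · a , a ⟫ ≡ + 0 → p ≡ + 0 × q ≡ + 0
      orthogonal⇒trivial p q ⊥v ⊥a =
        ℤP.*-cancelʳ-≡ p (+ 0) (+ m) (trans (sym (pairing-with-a p q)) ⊥a) ,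
        ℤP.*-cancelʳ-≡ q (+ 0) (+ m) (ℤP.neg-injective (trans (sym (pairing-with-v p q)) ⊥v))

      decompose : ∀ u → ∃[ p ] ∃[ q ] (⟪ u ⊖ (p · v ⊕ q · a) , v ⟫ ≡ + 0 × ⟪ u ⊖ (p · v ⊕ q · a) , a ⟫ ≡ + 0)
      decompose u with v-div u | a-div u
      ... | divides s vu≡sm | divides t au≡tm = - t , s , ⊥v , ⊥a
        where
        ⊥v : ⟪ u ⊖ (- t · v ⊕ s · a) , v ⟫ ≡ + 0
        ⊥v = begin
          ⟪ u ⊖ (- t · v ⊕ s · a) , v ⟫            ≡⟨ form-⊖ˡ u _ v ⟩
          ⟪ u , v ⟫ - ⟪ - t · v ⊕ s · a , v ⟫      ≡⟨ cong₂ _-_ (trans (form-antisym d u v) (cong -_ vu≡sm)) (pairing-with-v (- t) s) ⟩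
          - (s * + m) - - (s * + m)                ≡⟨ ℤP.+-inverseʳ (- (s * + m)) ⟩
          + 0                                      ∎
        ⊥a : ⟪ u ⊖ (- t · v ⊕ s · a) , a ⟫ ≡ + 0
        ⊥a = begin
          ⟪ u ⊖ (- t · v ⊕ s · a) , a ⟫            ≡⟨ form-⊖ˡ u _ a ⟩
          ⟪ u , a ⟫ - ⟪ - t · v ⊕ s · a , a ⟫      ≡⟨ cong₂ _-_ (trans (form-antisym d u a) (cong -_ au≡tm)) (pairing-with-a (- t) s) ⟩
          - (t * + m) - - t * + m                  ≡⟨ cong (λ x → - (t * + m) - x) (ℤP.neg-distribˡ-* t (+ m)) ⟨
          - (t * + m) - - (t * + m)                ≡⟨ ℤP.+-inverseʳ (- (t * + m)) ⟩
          + 0                                      ∎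

    splitPair⇒splitting : Splitting d v
    splitPair⇒splitting =
      splitPair⇒primitive , v , a , independent , (+ 1 , + 0 , v-in-span) , decompose , disjoint
      where
      independent : ∀ p q → p · v ⊕ q · a ≡ 0L → p ≡ + 0 × q ≡ + 0
      independent p q x≡0 = orthogonal⇒trivial p q (orthogonal v) (orthogonal a)
        where
        orthogonal : ∀ t → ⟪ p · v ⊕ q · a , t ⟫ ≡ + 0
        orthogonal t = trans (cong (λ x → ⟪ x , t ⟫) x≡0) (form-0ˡ d t)

      v-in-span : v ≡ + 1 · v ⊕ + 0 · a
      v-in-span = sym (trans (cong₂ _⊕_ (·-identityˡ v) (·-zeroˡ a)) (⊕-identityʳ v))

      disjoint : ∀ p q → ⟪ p · v ⊕ q · a , v ⟫ ≡ + 0 → ⟪ p · v ⊕ q · a , a ⟫ ≡ + 0 → p · v ⊕ q · a ≡ 0L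
      disjoint p q ⊥v ⊥a with orthogonal⇒trivial p q ⊥v ⊥a
      ... | refl , refl = trans (cong₂ _⊕_ (·-zeroˡ v) (·-zeroˡ a)) (⊕-identityʳ 0L)

  splitPair⇒splittingD : ∀ {v a m} → SplitPair v a m → SplittingD d (v , m)
  splitPair⇒splittingD {v} {a} {m} sp =
    m , primitive-order (splitPair⇒primitive sp) m≥1 ,
    (a , m) , (m≥1 , λ u → ∣⇒∣ᵤ (a-div u)) ,
    primitive-order (splitPair⇒primitive (splitPair-swap sp)) m≥1 ,
    ∣⇒∣ᵤ {+ (m ℕ.* m ℕ.* m)} (divides (+ 0) (begin
      + m * ⟪ v , a ⟫ - + (m ℕ.* m)   ≡⟨ cong₂ (λ x y → + m * x - y) pairing (ℤP.pos-* m m) ⟩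
      + m * + m - + m * + m           ≡⟨ ℤP.+-inverseʳ (+ m * + m) ⟩
      + 0                             ∎))
    where open SplitPair sp

  splitPair-lift : ∀ {v u z k} → 1 ℕ.≤ k → (∀ t → + k ∣ ⟪ v , t ⟫) → (∀ t → + k ∣ ⟪ u , t ⟫)
    → + k * + k ∣ ⟪ v , u ⟫ - + k → ⟪ v , z ⟫ ≡ + k → ∃[ a ] SplitPair v a k
  splitPair-lift {v} {u} {z} {k} k≥1 v-div u-div (divides Q vu≡k) vz≡k =
    u ⊕ c · z , record { m≥1 = k≥1 ; pairing = pairing ; v-div = v-div ; a-div = a-div }
    where
    c : ℤ
    c = - (Q * + k)

    pairing : ⟪ v , u ⊕ c · z ⟫ ≡ + k
    pairing = ℤP.i-j≡0⇒i≡j ⟪ v , u ⊕ c · z ⟫ (+ k) (begin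
      ⟪ v , u ⊕ c · z ⟫ - + k                ≡⟨ cong (λ x → x - + k) (form-⊕ʳ v u (c · z)) ⟩
      ⟪ v , u ⟫ + ⟪ v , c · z ⟫ - + k         ≡⟨ cong (λ x → ⟪ v , u ⟫ + x - + k) (trans (form-·ʳ v c z) (cong (c *_) vz≡k)) ⟩
      ⟪ v , u ⟫ + c * + k - + k               ≡⟨ expand ⟪ v , u ⟫ c (+ k) ⟩
      (⟪ v , u ⟫ - + k) + c * + k             ≡⟨ cong (λ x → x + c * + k) vu≡k ⟩
      Q * (+ k * + k) + - (Q * + k) * + k     ≡⟨ cancel Q (+ k) ⟩
      + 0                                     ∎)
      where
      expand : ∀ x c k → x + c * k - k ≡ (x - k) + c * k
      expand = solve-∀
      cancel : ∀ Q k → Q * (k * k) + - (Q * k) * k ≡ + 0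
      cancel = solve-∀

    a-div : ∀ t → + k ∣ ⟪ u ⊕ c · z , t ⟫
    a-div t = subst (+ k ∣_) (sym (trans (form-⊕ˡ d u (c · z) t) (cong (λ x → ⟪ u , t ⟫ + x) (form-·ˡ d c z t))))
                (∣m∣n⇒∣m+n (u-div t) (∣m⇒∣m*n ⟪ z , t ⟫ (∣m⇒∣-m (∣n⇒∣m*n Q ∣-refl))))

  projection-pairing : ∀ {a b u p′ q′} → ⟪ u ⊖ (p′ · a ⊕ q′ · b) , a ⟫ ≡ + 0 → ⟪ u ⊖ (p′ · a ⊕ q′ · b) , b ⟫ ≡ + 0
    → ∀ p q → ⟪ p · a ⊕ q · b , u ⟫ ≡ (p * q′ - q * p′) * ⟪ a , b ⟫
  projection-pairing {a} {b} {u} {p′} {q′} ⊥a ⊥b p q = begin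
    ⟪ x , u ⟫                        ≡⟨ cong (λ t → ⟪ x , t ⟫) (⊕-⊖-cancel u y) ⟨
    ⟪ x , y ⊕ (u ⊖ y) ⟫              ≡⟨ form-⊕ʳ x y (u ⊖ y) ⟩
    ⟪ x , y ⟫ + ⟪ x , u ⊖ y ⟫        ≡⟨ cong₂ _+_ (hyperbolic-gram a b p q p′ q′) (span-orthogonal p a q b (u ⊖ y) ⊥a ⊥b) ⟩
    (p * q′ - q * p′) * ⟪ a , b ⟫ + + 0 ≡⟨ ℤP.+-identityʳ _ ⟩
    (p * q′ - q * p′) * ⟪ a , b ⟫    ∎
    where
    x y : L g
    x = p · a ⊕ q · b
    y = p′ · a ⊕ q′ · b

  primitive-span-div : ∀ {a b p q δ} → Primitive d (p · a ⊕ q · b) → ⟪ a , b ⟫ ≢ + 0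
    → δ * ⟪ a , b ⟫ ∣ ⟪ p · a ⊕ q · b , a ⟫ → δ * ⟪ a , b ⟫ ∣ ⟪ p · a ⊕ q · b , b ⟫ → δ * ⟪ a , b ⟫ ∣ ⟪ a , b ⟫
  primitive-span-div {a} {b} {p} {q} {δ} prim e≢0 δe∣va δe∣vb =
    subst (δ * e ∣_) (ℤP.*-identityˡ e) (*-monoˡ-∣ e (primitive-span-coprime {a} {b} {p} {q} {δ} prim δ∣p δ∣q))
    where
    e : ℤ
    e = ⟪ a , b ⟫

    instance
      e-nonZero : ℤ.NonZero e
      e-nonZero = ℤ.≢-nonZero e≢0

    δ∣p : δ ∣ p
    δ∣p = *-cancelʳ-∣ e (subst (δ * e ∣_) (begin
      ⟪ p · a ⊕ q · b , b ⟫            ≡⟨ form-span p a q b b ⟩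
      p * ⟪ a , b ⟫ + q * ⟪ b , b ⟫    ≡⟨ cong (λ x → p * e + q * x) (form-self d b) ⟩
      p * e + q * + 0                  ≡⟨ expand p q e ⟩
      p * e                            ∎) δe∣vb)
      where
      expand : ∀ p q e → p * e + q * + 0 ≡ p * e
      expand = solve-∀

    δ∣q : δ ∣ q
    δ∣q = *-cancelʳ-∣ e (subst (δ * e ∣_) (begin
      - ⟪ p · a ⊕ q · b , a ⟫              ≡⟨ cong -_ (form-span p a q b a) ⟩
      - (p * ⟪ a , a ⟫ + q * ⟪ b , a ⟫)    ≡⟨ cong₂ (λ x y → - (p * x + q * y)) (form-self d a) (form-antisym d b a) ⟩
      - (p * + 0 + q * - e)                ≡⟨ expand p q e ⟩
      q * e                                ∎) (∣m⇒∣-m δe∣va))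
      where
      expand : ∀ p q e → - (p * + 0 + q * - e) ≡ q * e
      expand = solve-∀

  -- Projecting a vector z with (v , z) = m to ⟨a , b⟩ gives W with (v , W) = m, and primitivity of
  -- v = p a + q b forces m ∣ (a , b), hence m ∣ (W , ·).
  splitting⇒splitPair : ∀ {v m} → Splitting d v → IsDiv d v m → ∃[ a ] SplitPair v a m
  splitting⇒splitPair {m = m} (prim , a , b , _ , (p , q , refl) , decompose , _) (m≥1 , v-div , z , vz≡m)
    with decompose z
  ... | p₀ , q₀ , z⊥a , z⊥b =
    W , record { m≥1 = m≥1 ; pairing = vW≡m ; v-div = λ u → ∣ᵤ⇒∣ (v-div u) ; a-div = W-div }
    where
    e δ : ℤ
    e = ⟪ a , b ⟫
    δ = p * q₀ - q * p₀

    W : L g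
    W = p₀ · a ⊕ q₀ · b

    m≡δe : + m ≡ δ * e
    m≡δe = trans (sym vz≡m) (projection-pairing {a} {b} {z} {p₀} {q₀} z⊥a z⊥b p q)

    vW≡m : ⟪ p · a ⊕ q · b , W ⟫ ≡ + m
    vW≡m = trans (hyperbolic-gram a b p q p₀ q₀) (sym m≡δe)

    e≢0 : e ≢ + 0
    e≢0 e≡0 = pos≢0 m≥1 (trans m≡δe (trans (cong (δ *_) e≡0) (ℤP.*-zeroʳ δ)))

    m∣e : + m ∣ e
    m∣e = subst (_∣ e) (sym m≡δe) (primitive-span-div {a} {b} {p} {q} {δ} prim e≢0 (m∣ a) (m∣ b))
      where
      m∣ : ∀ t → δ * e ∣ ⟪ p · a ⊕ q · b , t ⟫
      m∣ t = subst (_∣ ⟪ p · a ⊕ q · b , t ⟫) m≡δe (∣ᵤ⇒∣ (v-div t))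

    W-div : ∀ u → + m ∣ ⟪ W , u ⟫
    W-div u with decompose u
    ... | p′ , q′ , ⊥a , ⊥b = subst (+ m ∣_) (sym (projection-pairing {a} {b} {u} {p′} {q′} ⊥a ⊥b p₀ q₀)) (∣n⇒∣m*n (p₀ * q′ - q₀ * p′) m∣e)

  -- The discriminant group D_Λ

  ≈D-sym : ∀ {A B n n′} → _≈D_ d (A , n) (B , n′) → _≈D_ d (B , n′) (A , n)
  ≈D-sym {A} {B} {n} {n′} (U , eq) = -1ℤ · U , (begin
    (+ n) · B ⊖ (+ n′) · A            ≡⟨ ⊖-swap _ _ ⟩
    -1ℤ · ((+ n′) · A ⊖ (+ n) · B)    ≡⟨ cong (-1ℤ ·_) eq ⟩
    -1ℤ · ((+ n * + n′) · U)          ≡⟨ ·-assoc -1ℤ (+ n * + n′) U ⟨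
    (-1ℤ * (+ n * + n′)) · U          ≡⟨ cong (_· U) (expand (+ n) (+ n′)) ⟩
    ((+ n′ * + n) * -1ℤ) · U          ≡⟨ ·-assoc (+ n′ * + n) -1ℤ U ⟩
    (+ n′ * + n) · (-1ℤ · U)          ∎)
    where
    expand : ∀ n n′ → - + 1 * (n * n′) ≡ (n′ * n) * - + 1
    expand = solve-∀

  ≈D-trans : ∀ {A B C n} → _≈D_ d (A , n) (B , n) → _≈D_ d (B , n) (C , n) → _≈D_ d (A , n) (C , n)
  ≈D-trans {A} {B} {C} {n} (U , AB) (U′ , BC) = U ⊕ U′ , (begin
    (+ n) · A ⊖ (+ n) · C                                ≡⟨ ⊖-telescope _ ((+ n) · B) _ ⟩
    ((+ n) · A ⊖ (+ n) · B) ⊕ ((+ n) · B ⊖ (+ n) · C)    ≡⟨ cong₂ _⊕_ AB BC ⟩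
    (+ n * + n) · U ⊕ (+ n * + n) · U′                   ≡⟨ ·-distribˡ (+ n * + n) U U′ ⟨
    (+ n * + n) · (U ⊕ U′)                               ∎)

  shift⇒≈D : ∀ {A B n} → ∃[ W ] A ≡ B ⊕ (+ n) · W → _≈D_ d (A , n) (B , n)
  shift⇒≈D {B = B} {n} (W , refl) = W , scale-shift (+ n) (+ n) B W

  ≈D⇒shift : ∀ {A B n} → 1 ℕ.≤ n → _≈D_ d (A , n) (B , n) → ∃[ W ] A ≡ B ⊕ (+ n) · W
  ≈D⇒shift {A} {B} {n} n≥1 (U , eq) =
    U , ·-cancelˡ (+ n) {{ℕ.>-nonZero n≥1}} (⊕-cancelʳ _ _ _ (trans eq (sym (scale-shift (+ n) (+ n) B U))))

  ≈D⇒div-∣ : ∀ {v w m m′} → Primitive d v → 1 ℕ.≤ m → _≈D_ d (v , m) (w , m′) → m ℕD.∣ m′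
  ≈D⇒div-∣ {v} {w} {m} {m′} prim m≥1 (U , eq) =
    ∣⇒∣ᵤ (primitive-∣ {p = + m′} {q = + m} prim (pos≢0 m≥1) (⊕-cancelʳ _ _ _ (begin
      (+ m) · (w ⊕ (+ m′) · U) ⊖ (+ m) · w   ≡⟨ scale-shift (+ m) (+ m′) w U ⟩
      (+ m′ * + m) · U                       ≡⟨ cong (_· U) (ℤP.*-comm (+ m′) (+ m)) ⟩
      (+ m * + m′) · U                       ≡⟨ eq ⟨
      (+ m′) · v ⊖ (+ m) · w                 ∎)))

  ≈D⇒same-div : ∀ {v w m m′} → Primitive d v → Primitive d w → 1 ℕ.≤ m → 1 ℕ.≤ m′
    → _≈D_ d (v , m) (w , m′) → m ≡ m′
  ≈D⇒same-div {v} {w} {m} {m′} prim-v prim-w m≥1 m′≥1 v≈w =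
    ℕD.∣-antisym (≈D⇒div-∣ {v} {w} prim-v m≥1 v≈w) (≈D⇒div-∣ {w} {v} prim-w m′≥1 (≈D-sym {v} {w} {m} {m′} v≈w))

  rescale-dual : ∀ {w n k u} → InDual d (w , n) → (+ k) · w ≡ (+ n) · u → ∀ t → + k ∣ ⟪ u , t ⟫
  rescale-dual {w} {n} {k} {u} (n≥1 , w-div) kw≡nu t with ∣ᵤ⇒∣ (w-div t)
  ... | divides s wt≡sn = divides s (ℤP.*-cancelˡ-≡ (+ n) _ _ {{ℕ.>-nonZero n≥1}} (begin
    + n * ⟪ u , t ⟫       ≡⟨ form-·ˡ d (+ n) u t ⟨
    ⟪ (+ n) · u , t ⟫     ≡⟨ cong (λ x → ⟪ x , t ⟫) kw≡nu ⟨
    ⟪ (+ k) · w , t ⟫     ≡⟨ form-·ˡ d (+ k) w t ⟩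
    + k * ⟪ w , t ⟫       ≡⟨ cong (+ k *_) wt≡sn ⟩
    + k * (s * + n)       ≡⟨ expand (+ k) s (+ n) ⟩
    + n * (s * + k)       ∎))
    where
    expand : ∀ k s n → k * (s * n) ≡ n * (s * k)
    expand = solve-∀

  lift-pairing : ∀ {w w′ u u′ n n′ k} → 1 ℕ.≤ n → 1 ℕ.≤ n′
    → (+ k) · w ≡ (+ n) · u → (+ k) · w′ ≡ (+ n′) · u′
    → PairingIsInv d (w , n) (w′ , n′) k → + k * + k ∣ ⟪ u , u′ ⟫ - + k
  lift-pairing {w} {w′} {u} {u′} {suc n} {suc n′} {k} _ _ kw≡nu kw′≡n′u′ inv with ∣ᵤ⇒∣ inv
  ... | divides Q kww′≡ = divides Q (ℤP.*-cancelˡ-≡ N _ _ (begin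
    N * (⟪ u , u′ ⟫ - + k)                     ≡⟨ expand₁ (+ suc n) (+ suc n′) ⟪ u , u′ ⟫ (+ k) ⟩
    + suc n * (+ suc n′ * ⟪ u , u′ ⟫) - N * + k  ≡⟨ cong (λ x → x - N * + k) lifts ⟩
    + k * (+ k * ⟪ w , w′ ⟫) - N * + k         ≡⟨ expand₂ (+ k) ⟪ w , w′ ⟫ N ⟩
    + k * (+ k * ⟪ w , w′ ⟫ - N)               ≡⟨ cong (+ k *_) inverse ⟩
    + k * (Q * (+ k * N))                      ≡⟨ expand₃ (+ k) Q N ⟩
    N * (Q * (+ k * + k))                      ∎))
    where
    N : ℤ
    N = + suc n * + suc n′

    lifts : + suc n * (+ suc n′ * ⟪ u , u′ ⟫) ≡ + k * (+ k * ⟪ w , w′ ⟫)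
    lifts = begin
      + suc n * (+ suc n′ * ⟪ u , u′ ⟫)    ≡⟨ form-scale (+ suc n) (+ suc n′) u u′ ⟨
      ⟪ (+ suc n) · u , (+ suc n′) · u′ ⟫  ≡⟨ cong₂ ⟪_,_⟫ kw≡nu kw′≡n′u′ ⟨
      ⟪ (+ k) · w , (+ k) · w′ ⟫           ≡⟨ form-scale (+ k) (+ k) w w′ ⟩
      + k * (+ k * ⟪ w , w′ ⟫)             ∎

    inverse : + k * ⟪ w , w′ ⟫ - N ≡ Q * (+ k * N)
    inverse = begin
      + k * ⟪ w , w′ ⟫ - N                        ≡⟨ cong (λ x → + k * ⟪ w , w′ ⟫ - x) (ℤP.pos-* (suc n) (suc n′)) ⟨
      + k * ⟪ w , w′ ⟫ - + (suc n ℕ.* suc n′)     ≡⟨ kww′≡ ⟩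
      Q * + (k ℕ.* suc n ℕ.* suc n′)              ≡⟨ cong (Q *_) (trans (ℤP.pos-* (k ℕ.* suc n) (suc n′)) (cong (_* + suc n′) (ℤP.pos-* k (suc n)))) ⟩
      Q * (+ k * + suc n * + suc n′)              ≡⟨ cong (Q *_) (ℤP.*-assoc (+ k) (+ suc n) (+ suc n′)) ⟩
      Q * (+ k * N)                               ∎

    expand₁ : ∀ n n′ x k → (n * n′) * (x - k) ≡ n * (n′ * x) - (n * n′) * k
    expand₁ = solve-∀
    expand₂ : ∀ k x N → k * (k * x) - N * k ≡ k * (k * x - N)
    expand₂ = solve-∀
    expand₃ : ∀ k Q N → k * (Q * (k * N)) ≡ N * (Q * (k * k))
    expand₃ = solve-∀

  -- x = [w/n] of order k written as [u/k], together with y = [u′/k] such that (x , y) = 1/k.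
  record SplittingLift (w : L g) (n : ℕ) : Set where
    field
      k       : ℕ
      order   : HasOrder d (w , n) k
      u u′    : L g
      u-lifts : (+ k) · w ≡ (+ n) · u
      u-dual  : ∀ t → + k ∣ ⟪ u , t ⟫
      u′-dual : ∀ t → + k ∣ ⟪ u′ , t ⟫
      pairing : + k * + k ∣ ⟪ u , u′ ⟫ - + k

  splittingD⇒lift : ∀ {w n} → InDual d (w , n) → SplittingD d (w , n) → SplittingLift w n
  splittingD⇒lift w∈dual@(n≥1 , _)
    (k , order@(_ , (u , kw≡nu) , _) , _ , w′∈dual@(n′≥1 , _) , (_ , (u′ , kw′≡n′u′) , _) , inverse) = record
    { k = k ; order = order ; u = u ; u′ = u′ ; u-lifts = kw≡nu
    ; u-dual = rescale-dual w∈dual kw≡nu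
    ; u′-dual = rescale-dual w′∈dual kw′≡n′u′
    ; pairing = lift-pairing n≥1 n′≥1 kw≡nu kw′≡n′u′ inverse
    }

  splitting⇒splittingD : ∀ {v m} → Splitting d v → IsDiv d v m → SplittingD d (v , m)
  splitting⇒splittingD sp v-isDiv = splitPair⇒splittingD (proj₂ (splitting⇒splitPair sp v-isDiv))

  splittingD⇒splitting : ∀ {v m} → Primitive d v → IsDiv d v m → SplittingD d (v , m) → Splitting d v
  splittingD⇒splitting {v} {m} prim (m≥1 , v-div , z , vz≡m) sD with splittingD⇒lift (m≥1 , v-div) sD
  ... | record { k = k ; order = order ; u = u ; u′ = u′ ; u-lifts = kv≡mu ; u′-dual = u′-dual ; pairing = pairing }
    with order-unique {v , m} order (primitive-order prim m≥1)
  ... | refl with ·-cancelˡ (+ m) {{ℕ.>-nonZero m≥1}} kv≡mu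
  ... | refl = splitPair⇒splitting (proj₂ (splitPair-lift m≥1 (λ t → ∣ᵤ⇒∣ (v-div t)) u′-dual pairing vz≡m))

  shift-dual : ∀ {u k} s → (∀ t → + k ∣ ⟪ u , t ⟫) → ∀ t → + k ∣ ⟪ u ⊕ (+ k) · s , t ⟫
  shift-dual {u} {k} s u-dual t =
    subst (+ k ∣_) (sym (form-shift u k s t)) (∣m∣n⇒∣m+n (u-dual t) (∣m⇒∣m*n ⟪ s , t ⟫ ∣-refl))
    where
    form-shift : ∀ u k s t → ⟪ u ⊕ (+ k) · s , t ⟫ ≡ ⟪ u , t ⟫ + + k * ⟪ s , t ⟫
    form-shift u k s t = trans (form-⊕ˡ d u ((+ k) · s) t) (cong (λ x → ⟪ u , t ⟫ + x) (form-·ˡ d (+ k) s t))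

  shift-pairing : ∀ {u u′ k} s → (∀ t → + k ∣ ⟪ u′ , t ⟫)
    → + k * + k ∣ ⟪ u , u′ ⟫ - + k → + k * + k ∣ ⟪ u ⊕ (+ k) · s , u′ ⟫ - + k
  shift-pairing {u} {u′} {k} s u′-dual uu′≡k =
    subst (+ k * + k ∣_) (sym (begin
      ⟪ u ⊕ (+ k) · s , u′ ⟫ - + k               ≡⟨ cong (λ x → x - + k) (form-⊕ˡ d u ((+ k) · s) u′) ⟩
      ⟪ u , u′ ⟫ + ⟪ (+ k) · s , u′ ⟫ - + k       ≡⟨ cong (λ x → ⟪ u , u′ ⟫ + x - + k) (form-·ˡ d (+ k) s u′) ⟩
      ⟪ u , u′ ⟫ + + k * ⟪ s , u′ ⟫ - + k         ≡⟨ expand ⟪ u , u′ ⟫ (+ k) ⟪ s , u′ ⟫ ⟩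
      (⟪ u , u′ ⟫ - + k) + + k * ⟪ s , u′ ⟫       ∎))
      (∣m∣n⇒∣m+n uu′≡k (*-monoʳ-∣ (+ k) k∣su′))
    where
    expand : ∀ x k y → x + k * y - k ≡ (x - k) + k * y
    expand = solve-∀
    k∣su′ : + k ∣ ⟪ s , u′ ⟫
    k∣su′ = subst (+ k ∣_) (sym (form-antisym d s u′)) (∣m⇒∣-m (u′-dual s))

  unimodular-shift : ∀ {e f u k} → ⟪ e , f ⟫ ≡ + 1 → + k ∣ ⟪ u , f ⟫ → ∃[ s ] ⟪ u ⊕ (+ k) · s , f ⟫ ≡ + k
  unimodular-shift {e} {f} {u} {k} ef≡1 (divides c uf≡ck) = (+ 1 - c) · e , (begin
    ⟪ u ⊕ (+ k) · s , f ⟫                      ≡⟨ form-⊕ˡ d u ((+ k) · s) f ⟩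
    ⟪ u , f ⟫ + ⟪ (+ k) · s , f ⟫              ≡⟨ cong₂ _+_ uf≡ck (trans (form-·ˡ d (+ k) s f) (cong (+ k *_) (form-·ˡ d (+ 1 - c) e f))) ⟩
    c * + k + + k * ((+ 1 - c) * ⟪ e , f ⟫)    ≡⟨ cong (λ x → c * + k + + k * ((+ 1 - c) * x)) ef≡1 ⟩
    c * + k + + k * ((+ 1 - c) * + 1)          ≡⟨ expand c (+ k) ⟩
    + k                                        ∎)
    where
    s : L g
    s = (+ 1 - c) · e
    expand : ∀ c k → c * k + k * ((+ 1 - c) * + 1) ≡ k
    expand = solve-∀

  splittingD⇒realised : ∀ {e f} → ⟪ e , f ⟫ ≡ + 1 → ∀ {w n} → InDual d (w , n) → SplittingD d (w , n)
    → ∃[ v ] ∃[ m ] (Splitting d v × IsDiv d v m × _≈D_ d (v , m) (w , n))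
  splittingD⇒realised {e} {f} ef≡1 {w} {n} w∈dual sD with splittingD⇒lift w∈dual sD
  ... | record { k = k ; order = (k≥1 , _) ; u = u ; u′ = u′ ; u-lifts = kw≡nu ; u-dual = u-dual ; u′-dual = u′-dual ; pairing = pairing }
    with unimodular-shift {e} {f} {u} {k} ef≡1 (u-dual f)
  ... | s , vf≡k =
    u ⊕ (+ k) · s , k , splitPair⇒splitting (proj₂ v-split) , splitPair⇒isDiv (proj₂ v-split) , s , class
    where
    v-split : ∃[ a ] SplitPair (u ⊕ (+ k) · s) a k
    v-split = splitPair-lift k≥1 (shift-dual s u-dual) u′-dual (shift-pairing {u} s u′-dual pairing) vf≡k

    class : (+ n) · (u ⊕ (+ k) · s) ⊖ (+ k) · w ≡ (+ k * + n) · s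
    class = trans (cong (λ x → (+ n) · (u ⊕ (+ k) · s) ⊖ x) kw≡nu) (scale-shift (+ n) (+ k) u s)

  -- The group Γ_Λ and Eichler transvections

  InΓ-preserves-dual : ∀ {γ w n} → InΓ d γ → InDual d (w , n) → InDual d (γ w , n)
  InΓ-preserves-dual {γ} {w} {n} (_ , (δ , _ , γδ) , preserves , _) (n≥1 , w-div) = n≥1 , λ u →
    subst (+ n ∣ᵤ_) (trans (sym (preserves w (δ u))) (cong (λ x → ⟪ γ w , x ⟫) (γδ u))) (w-div (δ u))

  InΓ-∘ : ∀ {γ γ′} → InΓ d γ → InΓ d γ′ → InΓ d (λ u → γ (γ′ u))
  InΓ-∘ {γ} {γ′} (additive , (δ , δγ , γδ) , preserves , trivial) γ′∈Γ@(additive′ , (δ′ , δγ′ , γδ′) , preserves′ , trivial′) =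
    (λ u w → trans (cong γ (additive′ u w)) (additive (γ′ u) (γ′ w))) ,
    ((λ u → δ′ (δ u)) , (λ u → trans (cong δ′ (δγ (γ′ u))) (δγ′ u)) , (λ u → trans (cong γ (γδ′ (δ u))) (γδ u))) ,
    (λ u w → trans (preserves (γ′ u) (γ′ w)) (preserves′ u w)) ,
    (λ w n w∈dual → ≈D-trans {γ (γ′ w)} {γ′ w} {w} {n} (trivial (γ′ w) n (InΓ-preserves-dual γ′∈Γ w∈dual)) (trivial′ w n w∈dual))

  InΓ-inverse : ∀ {γ} → InΓ d γ → ∃[ δ ] (InΓ d δ × (∀ u → δ (γ u) ≡ u) × (∀ u → γ (δ u) ≡ u))
  InΓ-inverse {γ} (additive , (δ , δγ , γδ) , preserves , trivial) =
    δ , (δ-additive , (γ , γδ , δγ) , δ-preserves , δ-trivial) , δγ , γδ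
    where
    δ-additive : ∀ u w → δ (u ⊕ w) ≡ δ u ⊕ δ w
    δ-additive u w = begin
      δ (u ⊕ w)                ≡⟨ cong δ (cong₂ _⊕_ (γδ u) (γδ w)) ⟨
      δ (γ (δ u) ⊕ γ (δ w))    ≡⟨ cong δ (additive (δ u) (δ w)) ⟨
      δ (γ (δ u ⊕ δ w))        ≡⟨ δγ _ ⟩
      δ u ⊕ δ w                ∎

    δ-preserves : ∀ u w → ⟪ δ u , δ w ⟫ ≡ ⟪ u , w ⟫
    δ-preserves u w = trans (sym (preserves (δ u) (δ w))) (cong₂ ⟪_,_⟫ (γδ u) (γδ w))

    δ-trivial : ∀ w n → InDual d (w , n) → _≈D_ d (δ w , n) (w , n)
    δ-trivial w n (n≥1 , w-div) = ≈D-sym {w} {δ w} {n} {n} (subst (λ x → _≈D_ d (x , n) (δ w , n)) (γδ w) (trivial (δ w) n δw∈dual))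
      where
      δw∈dual : InDual d (δ w , n)
      δw∈dual = n≥1 , λ u → subst (+ n ∣ᵤ_) (trans (cong (λ x → ⟪ x , γ u ⟫) (sym (γδ w))) (preserves (δ w) u)) (w-div (γ u))

  InΓ-preserves-primitive : ∀ {γ v} → InΓ d γ → Primitive d v → Primitive d (γ v)
  InΓ-preserves-primitive {γ} {v} γ∈Γ@(additive , _) (v≢0 , multiple) with InΓ-inverse γ∈Γ
  ... | δ , (δ-additive , _) , δγ , γδ = γv≢0 , γ-multiple
    where
    γv≢0 : γ v ≢ 0L
    γv≢0 γv≡0 = v≢0 (trans (sym (δγ v)) (trans (cong δ γv≡0) (additive⇒zero δ δ-additive)))

    γ-multiple : ∀ w p q → q ≢ + 0 → q · w ≡ p · γ v → ∃[ k ] w ≡ k · γ v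
    γ-multiple w p q q≢0 qw≡pγv with multiple (δ w) p q q≢0 (begin
      q · δ w          ≡⟨ additive⇒linear δ δ-additive q w ⟨
      δ (q · w)        ≡⟨ cong δ qw≡pγv ⟩
      δ (p · γ v)      ≡⟨ additive⇒linear δ δ-additive p (γ v) ⟩
      p · δ (γ v)      ≡⟨ cong (p ·_) (δγ v) ⟩
      p · v            ∎)
    ... | k , δw≡kv = k , trans (sym (γδ w)) (trans (cong γ δw≡kv) (additive⇒linear γ additive k v))

  InΓ-preserves-splitting : ∀ {γ v} → InΓ d γ → Splitting d v → Splitting d (γ v)
  InΓ-preserves-splitting {γ} {v} γ∈Γ@(additive , _ , preserves , _)
    (v-primitive , a , b , independent , (p , q , v≡pa+qb) , decompose , disjoint) with InΓ-inverse γ∈Γ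
  ... | δ , (δ-additive , _) , δγ , γδ =
    InΓ-preserves-primitive γ∈Γ v-primitive , γ a , γ b , γ-independent ,
    (p , q , trans (cong γ v≡pa+qb) (γ-span p q)) , γ-decompose , γ-disjoint
    where
    γ-span : ∀ p q → γ (p · a ⊕ q · b) ≡ p · γ a ⊕ q · γ b
    γ-span p q = trans (additive _ _) (cong₂ _⊕_ (additive⇒linear γ additive p a) (additive⇒linear γ additive q b))

    γ-independent : ∀ p q → p · γ a ⊕ q · γ b ≡ 0L → p ≡ + 0 × q ≡ + 0
    γ-independent p q x≡0 =
      independent p q (trans (sym (δγ _)) (trans (cong δ (trans (γ-span p q) x≡0)) (additive⇒zero δ δ-additive)))

    γ-decompose : ∀ u → ∃[ p ] ∃[ q ] (⟪ u ⊖ (p · γ a ⊕ q · γ b) , γ a ⟫ ≡ + 0 × ⟪ u ⊖ (p · γ a ⊕ q · γ b) , γ b ⟫ ≡ + 0)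
    γ-decompose u with decompose (δ u)
    ... | p , q , ⊥a , ⊥b = p , q , trans (preserved a) ⊥a , trans (preserved b) ⊥b
      where
      γ-difference : γ (δ u ⊖ (p · a ⊕ q · b)) ≡ u ⊖ (p · γ a ⊕ q · γ b)
      γ-difference = trans (additive _ _) (cong₂ _⊕_ (γδ u) (trans (additive⇒linear γ additive -1ℤ _) (cong (-1ℤ ·_) (γ-span p q))))
      preserved : ∀ t → ⟪ u ⊖ (p · γ a ⊕ q · γ b) , γ t ⟫ ≡ ⟪ δ u ⊖ (p · a ⊕ q · b) , t ⟫
      preserved t = trans (cong (λ x → ⟪ x , γ t ⟫) (sym γ-difference)) (preserves _ t)

    γ-disjoint : ∀ p q → ⟪ p · γ a ⊕ q · γ b , γ a ⟫ ≡ + 0 → ⟪ p · γ a ⊕ q · γ b , γ b ⟫ ≡ + 0 → p · γ a ⊕ q · γ b ≡ 0L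
    γ-disjoint p q ⊥a ⊥b =
      trans (sym (γ-span p q)) (trans (cong γ (disjoint p q (pulled-back ⊥a) (pulled-back ⊥b))) (additive⇒zero γ additive))
      where
      pulled-back : ∀ {t} → ⟪ p · γ a ⊕ q · γ b , γ t ⟫ ≡ + 0 → ⟪ p · a ⊕ q · b , t ⟫ ≡ + 0
      pulled-back {t} h = trans (sym (preserves _ t)) (trans (cong (λ x → ⟪ x , γ t ⟫) (γ-span p q)) h)

  InΓ-preserves-div : ∀ {γ v m m′} → InΓ d γ → IsDiv d v m → IsDiv d (γ v) m′ → m ≡ m′
  InΓ-preserves-div {γ} {v} {m} {m′} (_ , (δ , _ , γδ) , preserves , _) (_ , v-div , z , vz≡m) (_ , γv-div , z′ , γvz′≡m′) =
    ℕD.∣-antisym m∣m′ m′∣m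
    where
    m′∣m : + m′ ∣ᵤ + m
    m′∣m = subst (+ m′ ∣ᵤ_) (trans (preserves v z) vz≡m) (γv-div (γ z))
    m∣m′ : + m ∣ᵤ + m′
    m∣m′ = subst (+ m ∣ᵤ_) (trans (sym (preserves v (δ z′))) (trans (cong (λ x → ⟪ γ v , x ⟫) (γδ z′)) γvz′≡m′)) (v-div (δ z′))

  InΓ-fixes-class : ∀ {γ v m m′} → InΓ d γ → IsDiv d v m → IsDiv d (γ v) m′ → _≈D_ d (γ v , m′) (v , m)
  InΓ-fixes-class {γ} {v} γ∈Γ@(_ , _ , _ , trivial) v-isDiv@(m≥1 , v-div , _) γv-isDiv
    with InΓ-preserves-div {γ} {v} γ∈Γ v-isDiv γv-isDiv
  ... | refl = trivial v _ (m≥1 , v-div)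

  -- For (x , y) = 0: the Eichler transvection u ↦ u + (x , u) y + (y , u) x followed by u ↦ u + c (x , u) x.
  eichler : L g → L g → ℤ → L g → L g
  eichler x y c u = u ⊕ ⟪ x , u ⟫ · y ⊕ (⟪ y , u ⟫ + c * ⟪ x , u ⟫) · x

  eichler-form : ∀ x y c t u →
    ⟪ t , eichler x y c u ⟫ ≡ ⟪ t , u ⟫ + ⟪ x , u ⟫ * ⟪ t , y ⟫ + (⟪ y , u ⟫ + c * ⟪ x , u ⟫) * ⟪ t , x ⟫
  eichler-form x y c t u = begin
    ⟪ t , u ⊕ s · y ⊕ r · x ⟫                  ≡⟨ form-⊕ʳ t (u ⊕ s · y) (r · x) ⟩
    ⟪ t , u ⊕ s · y ⟫ + ⟪ t , r · x ⟫          ≡⟨ cong₂ _+_ (form-⊕ʳ t u (s · y)) (form-·ʳ t r x) ⟩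
    ⟪ t , u ⟫ + ⟪ t , s · y ⟫ + r * ⟪ t , x ⟫  ≡⟨ cong (λ z → ⟪ t , u ⟫ + z + r * ⟪ t , x ⟫) (form-·ʳ t s y) ⟩
    ⟪ t , u ⟫ + s * ⟪ t , y ⟫ + r * ⟪ t , x ⟫  ∎
    where
    s r : ℤ
    s = ⟪ x , u ⟫
    r = ⟪ y , u ⟫ + c * ⟪ x , u ⟫

  module _ {x y : L g} (c : ℤ) (x⊥y : ⟪ x , y ⟫ ≡ + 0) where

    private
      E : L g → L g
      E = eichler x y c

      y⊥x : ⟪ y , x ⟫ ≡ + 0
      y⊥x = trans (form-antisym d y x) (cong -_ x⊥y)

      drop-isotropic : ∀ a b c′ {p q} → p ≡ + 0 → q ≡ + 0 → a + b * p + c′ * q ≡ a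
      drop-isotropic a b c′ refl refl = expand a b c′
        where
        expand : ∀ a b c → a + b * + 0 + c * + 0 ≡ a
        expand = solve-∀

    eichler-fixes-x : ∀ u → ⟪ x , E u ⟫ ≡ ⟪ x , u ⟫
    eichler-fixes-x u = trans (eichler-form x y c x u) (drop-isotropic ⟪ x , u ⟫ ⟪ x , u ⟫ (⟪ y , u ⟫ + c * ⟪ x , u ⟫) x⊥y (form-self d x))

    eichler-fixes-y : ∀ u → ⟪ y , E u ⟫ ≡ ⟪ y , u ⟫
    eichler-fixes-y u = trans (eichler-form x y c y u) (drop-isotropic ⟪ y , u ⟫ ⟪ x , u ⟫ (⟪ y , u ⟫ + c * ⟪ x , u ⟫) (form-self d y) y⊥x)

    eichler-preserves : ∀ u w → ⟪ E u , E w ⟫ ≡ ⟪ u , w ⟫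
    eichler-preserves u w = begin
      ⟪ E u , E w ⟫
        ≡⟨ eichler-form x y c (E u) w ⟩
      ⟪ E u , w ⟫ + ⟪ x , w ⟫ * ⟪ E u , y ⟫ + (⟪ y , w ⟫ + c * ⟪ x , w ⟫) * ⟪ E u , x ⟫
        ≡⟨ cong (λ z → z + ⟪ x , w ⟫ * ⟪ E u , y ⟫ + (⟪ y , w ⟫ + c * ⟪ x , w ⟫) * ⟪ E u , x ⟫)
                (trans (form-antisym d (E u) w) (cong -_ (eichler-form x y c w u))) ⟩
      - (⟪ w , u ⟫ + ⟪ x , u ⟫ * ⟪ w , y ⟫ + (⟪ y , u ⟫ + c * ⟪ x , u ⟫) * ⟪ w , x ⟫)
        + ⟪ x , w ⟫ * ⟪ E u , y ⟫ + (⟪ y , w ⟫ + c * ⟪ x , w ⟫) * ⟪ E u , x ⟫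
        ≡⟨ cancel (form-antisym d w u) (form-antisym d w y) (form-antisym d w x)
                  (trans (form-antisym d (E u) y) (cong -_ (eichler-fixes-y u)))
                  (trans (form-antisym d (E u) x) (cong -_ (eichler-fixes-x u))) ⟩
      ⟪ u , w ⟫ ∎
      where
      cancel : ∀ {U Xu Yu Xw Yw Wu Wy Wx Ey Ex} → Wu ≡ - U → Wy ≡ - Yw → Wx ≡ - Xw → Ey ≡ - Yu → Ex ≡ - Xu
        → - (Wu + Xu * Wy + (Yu + c * Xu) * Wx) + Xw * Ey + (Yw + c * Xw) * Ex ≡ U
      cancel {U} {Xu} {Yu} {Xw} {Yw} refl refl refl refl refl = expand U Xu Yu Xw Yw c
        where
        expand : ∀ U Xu Yu Xw Yw c →
          - (- U + Xu * - Yw + (Yu + c * Xu) * - Xw) + Xw * - Yu + (Yw + c * Xw) * - Xu ≡ U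
        expand = solve-∀

    eichler-additive : ∀ u w → E (u ⊕ w) ≡ E u ⊕ E w
    eichler-additive u w = begin
      (u ⊕ w) ⊕ ⟪ x , u ⊕ w ⟫ · y ⊕ (⟪ y , u ⊕ w ⟫ + c * ⟪ x , u ⊕ w ⟫) · x
        ≡⟨ cong₂ (λ s r → (u ⊕ w) ⊕ s · y ⊕ r · x) (form-⊕ʳ x u w)
                 (trans (cong₂ (λ p q → p + c * q) (form-⊕ʳ y u w) (form-⊕ʳ x u w)) (expand ⟪ y , u ⟫ ⟪ y , w ⟫ ⟪ x , u ⟫ ⟪ x , w ⟫ c)) ⟩
      (u ⊕ w) ⊕ (⟪ x , u ⟫ + ⟪ x , w ⟫) · y ⊕ ((⟪ y , u ⟫ + c * ⟪ x , u ⟫) + (⟪ y , w ⟫ + c * ⟪ x , w ⟫)) · x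
        ≡⟨ ⊕-·-interchange u w y x ⟪ x , u ⟫ ⟪ x , w ⟫ (⟪ y , u ⟫ + c * ⟪ x , u ⟫) (⟪ y , w ⟫ + c * ⟪ x , w ⟫) ⟩
      E u ⊕ E w ∎
      where
      expand : ∀ Yu Yw Xu Xw c → Yu + Yw + c * (Xu + Xw) ≡ (Yu + c * Xu) + (Yw + c * Xw)
      expand = solve-∀

    eichler-inverseˡ : ∀ u → eichler x (-1ℤ · y) (- c) (E u) ≡ u
    eichler-inverseˡ u = begin
      E u ⊕ ⟪ x , E u ⟫ · (-1ℤ · y) ⊕ (⟪ -1ℤ · y , E u ⟫ + - c * ⟪ x , E u ⟫) · x
        ≡⟨ cong₂ (λ s r → E u ⊕ s · (-1ℤ · y) ⊕ r · x) (eichler-fixes-x u)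
                 (trans (cong₂ (λ p q → p + - c * q) (trans (form-·ˡ d -1ℤ y (E u)) (cong (-1ℤ *_) (eichler-fixes-y u))) (eichler-fixes-x u))
                        (expand ⟪ y , u ⟫ ⟪ x , u ⟫ c)) ⟩
      E u ⊕ ⟪ x , u ⟫ · (-1ℤ · y) ⊕ (- (⟪ y , u ⟫ + c * ⟪ x , u ⟫)) · x
        ≡⟨ shear-cancel u y x ⟪ x , u ⟫ (⟪ y , u ⟫ + c * ⟪ x , u ⟫) ⟩
      u ∎
      where
      expand : ∀ Y X c → - + 1 * Y + - c * X ≡ - (Y + c * X)
      expand = solve-∀

    eichler-shift : ∀ {w n} → + n ∣ ⟪ x , w ⟫ → + n ∣ ⟪ y , w ⟫ → ∃[ W ] E w ≡ w ⊕ (+ n) · W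
    eichler-shift {w} {n} (divides a xw≡an) (divides b yw≡bn) = a · y ⊕ (b + c * a) · x , (begin
      E w                                                    ≡⟨ cong₂ (λ s r → w ⊕ s · y ⊕ r · x) xw≡an (cong₂ (λ p q → p + c * q) yw≡bn xw≡an) ⟩
      w ⊕ (a * + n) · y ⊕ (b * + n + c * (a * + n)) · x      ≡⟨ shear-factor w y x a b c (+ n) ⟩
      w ⊕ (+ n) · (a · y ⊕ (b + c * a) · x)                  ∎)

    eichler-trivial : ∀ w n → InDual d (w , n) → _≈D_ d (E w , n) (w , n)
    eichler-trivial w n (n≥1 , w-div) = shift⇒≈D {n = n} (eichler-shift (divisible x) (divisible y))
      where
      divisible : ∀ t → + n ∣ ⟪ t , w ⟫
      divisible t = subst (+ n ∣_) (sym (form-antisym d t w)) (∣m⇒∣-m (∣ᵤ⇒∣ (w-div t)))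

  eichler∈Γ : ∀ {x y} c → ⟪ x , y ⟫ ≡ + 0 → InΓ d (eichler x y c)
  eichler∈Γ {x} {y} c x⊥y =
    eichler-additive c x⊥y ,
    (eichler x (-1ℤ · y) (- c) , eichler-inverseˡ c x⊥y , inverseʳ) ,
    eichler-preserves c x⊥y ,
    eichler-trivial c x⊥y
    where
    x⊥-y : ⟪ x , -1ℤ · y ⟫ ≡ + 0
    x⊥-y = trans (form-·ʳ x -1ℤ y) (cong (-1ℤ *_) x⊥y)
    inverseʳ : ∀ u → eichler x y c (eichler x (-1ℤ · y) (- c) u) ≡ u
    inverseʳ u = trans (cong₂ (λ y′ c′ → eichler x y′ c′ (eichler x (-1ℤ · y) (- c) u))
                              (trans (sym (·-identityˡ y)) (·-assoc -1ℤ -1ℤ y)) (sym (ℤP.neg-involutive c)))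
                       (eichler-inverseˡ (- c) x⊥-y u)

  eichler-translate : ∀ {x v Z m} → (∀ t → + m ∣ ⟪ v , t ⟫) → ⟪ x , v ⟫ ≡ + m → ⟪ x , Z ⟫ ≡ + 0
    → ∃[ γ ] (InΓ d γ × γ v ≡ v ⊕ (+ m) · Z)
  eichler-translate {x} {v} {Z} {m} v-div xv≡m x⊥Z with v-div Z
  ... | divides k vZ≡km = eichler x Z k , eichler∈Γ k x⊥Z , (begin
    v ⊕ ⟪ x , v ⟫ · Z ⊕ (⟪ Z , v ⟫ + k * ⟪ x , v ⟫) · x
      ≡⟨ cong₂ (λ s r → v ⊕ s · Z ⊕ r · x) xv≡m (trans (cong₂ (λ p q → p + k * q) Zv≡-km xv≡m) (cancel k (+ m))) ⟩
    v ⊕ (+ m) · Z ⊕ + 0 · x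
      ≡⟨ cong (λ t → v ⊕ (+ m) · Z ⊕ t) (·-zeroˡ x) ⟩
    v ⊕ (+ m) · Z ⊕ 0L
      ≡⟨ ⊕-identityʳ (v ⊕ (+ m) · Z) ⟩
    v ⊕ (+ m) · Z ∎)
    where
    Zv≡-km : ⟪ Z , v ⟫ ≡ - (k * + m)
    Zv≡-km = trans (form-antisym d Z v) (cong -_ vZ≡km)
    cancel : ∀ k m → - (k * m) + k * m ≡ + 0
    cancel = solve-∀

  normal-forms-conjugate : ∀ {x v w m} → 1 ℕ.≤ m → (∀ t → + m ∣ ⟪ v , t ⟫) → ⟪ x , v ⟫ ≡ + m → ⟪ x , w ⟫ ≡ + m
    → _≈D_ d (w , m) (v , m) → ∃[ γ ] (InΓ d γ × γ v ≡ w)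
  normal-forms-conjugate {x} {v} {w} {m} m≥1 v-div xv≡m xw≡m w≈v with ≈D⇒shift {w} {v} {m} m≥1 w≈v
  ... | Z , w≡v+mZ with eichler-translate {x} {v} {Z} {m} v-div xv≡m x⊥Z
    where
    x⊥Z : ⟪ x , Z ⟫ ≡ + 0
    x⊥Z = ℤP.*-cancelˡ-≡ (+ m) ⟪ x , Z ⟫ (+ 0) {{ℕ.>-nonZero m≥1}} (trans (∙-cancelˡ (+ m) (+ m * ⟪ x , Z ⟫) (+ 0) (begin
      + m + + m * ⟪ x , Z ⟫          ≡⟨ cong₂ _+_ xv≡m (form-·ʳ x (+ m) Z) ⟨
      ⟪ x , v ⟫ + ⟪ x , (+ m) · Z ⟫  ≡⟨ form-⊕ʳ x v ((+ m) · Z) ⟨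
      ⟪ x , v ⊕ (+ m) · Z ⟫          ≡⟨ cong (λ t → ⟪ x , t ⟫) w≡v+mZ ⟨
      ⟪ x , w ⟫                      ≡⟨ xw≡m ⟩
      + m                            ≡⟨ ℤP.+-identityʳ (+ m) ⟨
      + m + + 0                      ∎)) (sym (ℤP.*-zeroʳ (+ m))))
  ... | γ , γ∈Γ , γv≡v+mZ = γ , γ∈Γ , trans γv≡v+mZ (sym w≡v+mZ)

-- The case d₁ = 1

abs-sign : ∀ i → ∃[ σ ] + ℤ.∣ i ∣ ≡ σ * i
abs-sign (+ n) = + 1 , sym (ℤP.*-identityˡ (+ n))
abs-sign -[1+ n ] = -1ℤ , sym (ℤP.-1*i≡-i -[1+ n ])

bezout-+- : ∀ {G} α β x y → G ℕ.+ y ℕ.* ℤ.∣ β ∣ ≡ x ℕ.* ℤ.∣ α ∣ → ∃[ X ] ∃[ Y ] + G ≡ X * α + Y * β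
bezout-+- {G} α β x y eq with abs-sign α | abs-sign β
... | σ , ∣α∣≡σα | τ , ∣β∣≡τβ = + x * σ , - (+ y * τ) , (begin
  + G                                          ≡⟨ expand (+ G) (+ y * + ℤ.∣ β ∣) ⟩
  (+ G + + y * + ℤ.∣ β ∣) - + y * + ℤ.∣ β ∣     ≡⟨ cong (λ t → t - + y * + ℤ.∣ β ∣) eq-in-ℤ ⟩
  + x * + ℤ.∣ α ∣ - + y * + ℤ.∣ β ∣             ≡⟨ cong₂ (λ p q → + x * p - + y * q) ∣α∣≡σα ∣β∣≡τβ ⟩
  + x * (σ * α) - + y * (τ * β)                ≡⟨ regroup (+ x) σ α (+ y) τ β ⟩
  + x * σ * α + - (+ y * τ) * β                ∎)
  where
  open ≡-Reasoning
  eq-in-ℤ : + G + + y * + ℤ.∣ β ∣ ≡ + x * + ℤ.∣ α ∣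
  eq-in-ℤ = begin
    + G + + y * + ℤ.∣ β ∣        ≡⟨ cong (λ t → + G + t) (ℤP.pos-* y ℤ.∣ β ∣) ⟨
    + G + + (y ℕ.* ℤ.∣ β ∣)      ≡⟨ ℤP.pos-+ G (y ℕ.* ℤ.∣ β ∣) ⟨
    + (G ℕ.+ y ℕ.* ℤ.∣ β ∣)      ≡⟨ cong +_ eq ⟩
    + (x ℕ.* ℤ.∣ α ∣)            ≡⟨ ℤP.pos-* x ℤ.∣ α ∣ ⟩
    + x * + ℤ.∣ α ∣              ∎
  expand : ∀ g t → g ≡ (g + t) - t
  expand = solve-∀
  regroup : ∀ x σ α y τ β → x * (σ * α) - y * (τ * β) ≡ x * σ * α + - (y * τ) * β
  regroup = solve-∀

bezout-identity : ∀ {G} α β → Bézout.Identity G ℤ.∣ α ∣ ℤ.∣ β ∣ → ∃[ X ] ∃[ Y ] + G ≡ X * α + Y * β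
bezout-identity α β (Bézout.+- x y eq) = bezout-+- α β x y eq
bezout-identity α β (Bézout.-+ x y eq) with bezout-+- β α y x eq
... | Y , X , G≡Yβ+Xα = X , Y , trans G≡Yβ+Xα (ℤP.+-comm (Y * β) (X * α))

bezout : ∀ α β → ∃[ G ] ∃[ X ] ∃[ Y ] (+ G ≡ X * α + Y * β × + G ∣ α × + G ∣ β)
bezout α β with Bézout.lemma ℤ.∣ α ∣ ℤ.∣ β ∣
... | Bézout.result G gcd identity with bezout-identity α β identity
... | X , Y , G≡Xα+Yβ =
  G , X , Y , G≡Xα+Yβ , ∣ᵤ⇒∣ (proj₁ (GCD.commonDivisor gcd)) , ∣ᵤ⇒∣ (proj₂ (GCD.commonDivisor gcd))

sl₂-clearing : ∀ α β → ∃[ p ] ∃[ q ] ∃[ r ] ∃[ s ] (p * s - q * r ≡ + 1 × r * α + s * β ≡ + 0)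
sl₂-clearing α β with bezout α β
... | zero , _ , _ , _ , _ , divides B β≡B*0 = + 1 , + 0 , + 0 , + 1 , refl ,
  trans (ℤP.+-identityˡ (+ 1 * β)) (trans (ℤP.*-identityˡ β) (trans β≡B*0 (ℤP.*-zeroʳ B)))
... | suc G , X , Y , G≡Xα+Yβ , divides A α≡AG , divides B β≡BG = X , Y , - B , A , det , kill
  where
  open ≡-Reasoning
  det : X * A - Y * - B ≡ + 1
  det = ℤP.*-cancelʳ-≡ (X * A - Y * - B) (+ 1) (+ suc G) (begin
    (X * A - Y * - B) * + suc G           ≡⟨ expand X A Y B (+ suc G) ⟩
    X * (A * + suc G) + Y * (B * + suc G) ≡⟨ cong₂ (λ a b → X * a + Y * b) α≡AG β≡BG ⟨
    X * α + Y * β                         ≡⟨ G≡Xα+Yβ ⟨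
    + suc G                               ≡⟨ ℤP.*-identityˡ (+ suc G) ⟨
    + 1 * + suc G                         ∎)
    where
    expand : ∀ X A Y B G → (X * A - Y * - B) * G ≡ X * (A * G) + Y * (B * G)
    expand = solve-∀
  kill : - B * α + A * β ≡ + 0
  kill = trans (cong₂ (λ a b → - B * a + A * b) α≡AG β≡BG) (cancel A B (+ suc G))
    where
    cancel : ∀ A B G → - B * (A * G) + A * (B * G) ≡ + 0
    cancel = solve-∀

module UnimodularHead {g : ℕ} (ds : Vec ℕ g) where
  open Lattice (1 ∷ ds)
  open ≡-Reasoning

  e₁ f₁ : L (suc g)
  e₁ = (+ 1 , + 0) ∷ 0L
  f₁ = (+ 0 , + 1) ∷ 0L

  head-form : ∀ a b a′ b′ u w → ⟪ (a , b) ∷ u , (a′ , b′) ∷ w ⟫ ≡ a * b′ - b * a′ + form ds u w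
  head-form a b a′ b′ u w = cong (λ t → t + form ds u w) (ℤP.*-identityˡ (a * b′ - b * a′))

  e₁-pairing : ∀ a b u → ⟪ e₁ , (a , b) ∷ u ⟫ ≡ b
  e₁-pairing a b u = trans (head-form (+ 1) (+ 0) a b 0L u) (trans (cong (λ t → + 1 * b - + 0 * a + t) (form-0ˡ ds u)) (expand a b))
    where
    expand : ∀ a b → + 1 * b - + 0 * a + + 0 ≡ b
    expand = solve-∀

  f₁-pairing : ∀ a b u → ⟪ f₁ , (a , b) ∷ u ⟫ ≡ - a
  f₁-pairing a b u = trans (head-form (+ 0) (+ 1) a b 0L u) (trans (cong (λ t → + 0 * b - + 1 * a + t) (form-0ˡ ds u)) (expand a b))
    where
    expand : ∀ a b → + 0 * b - + 1 * a + + 0 ≡ - a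
    expand = solve-∀

  tail-pairing : ∀ z a b u → ⟪ (+ 0 , + 0) ∷ z , (a , b) ∷ u ⟫ ≡ form ds z u
  tail-pairing z a b u = trans (head-form (+ 0) (+ 0) a b z u) (expand a b (form ds z u))
    where
    expand : ∀ a b t → + 0 * b - + 0 * a + t ≡ t
    expand = solve-∀

  e₁f₁≡1 : ⟪ e₁ , f₁ ⟫ ≡ + 1
  e₁f₁≡1 = e₁-pairing (+ 0) (+ 1) 0L

  sl₂ : ℤ → ℤ → ℤ → ℤ → L (suc g) → L (suc g)
  sl₂ p q r s ((a , b) ∷ u) = (p * a + q * b , r * a + s * b) ∷ u

  sl₂-additive : ∀ p q r s u w → sl₂ p q r s (u ⊕ w) ≡ sl₂ p q r s u ⊕ sl₂ p q r s w
  sl₂-additive p q r s ((a , b) ∷ u) ((a′ , b′) ∷ w) =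
    cong (λ h → h ∷ (u ⊕ w)) (cong₂ _,_ (expand p q a b a′ b′) (expand r s a b a′ b′))
    where
    expand : ∀ p q a b a′ b′ → p * (a + a′) + q * (b + b′) ≡ (p * a + q * b) + (p * a′ + q * b′)
    expand = solve-∀

  dual-head-divisible : ∀ {a b u n} → InDual (1 ∷ ds) ((a , b) ∷ u , n) → + n ∣ a × + n ∣ b
  dual-head-divisible {a} {b} {u} {n} (_ , w-div) = n∣a , n∣b
    where
    w : L (suc g)
    w = (a , b) ∷ u
    n∣a : + n ∣ a
    n∣a = subst (+ n ∣_) (begin
      ⟪ w , f₁ ⟫     ≡⟨ form-antisym (1 ∷ ds) w f₁ ⟩
      - ⟪ f₁ , w ⟫   ≡⟨ cong -_ (f₁-pairing a b u) ⟩
      - - a          ≡⟨ ℤP.neg-involutive a ⟩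
      a              ∎) (∣ᵤ⇒∣ (w-div f₁))
    n∣b : + n ∣ b
    n∣b = subst (+ n ∣_) (begin
      - ⟪ w , e₁ ⟫   ≡⟨ cong -_ (form-antisym (1 ∷ ds) w e₁) ⟩
      - - ⟪ e₁ , w ⟫ ≡⟨ ℤP.neg-involutive ⟪ e₁ , w ⟫ ⟩
      ⟪ e₁ , w ⟫     ≡⟨ e₁-pairing a b u ⟩
      b              ∎) (∣m⇒∣-m {+ n} {⟪ w , e₁ ⟫} (∣ᵤ⇒∣ (w-div e₁)))

  sl₂-shift : ∀ p q r s {a b n} u → + n ∣ a → + n ∣ b → ∃[ W ] sl₂ p q r s ((a , b) ∷ u) ≡ ((a , b) ∷ u) ⊕ (+ n) · W
  sl₂-shift p q r s {n = n} u (divides α refl) (divides β refl) =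
    ((p - + 1) * α + q * β , r * α + (s - + 1) * β) ∷ 0L ,
    cong₂ _∷_ (cong₂ _,_ (expand p q α β (+ n)) (expand′ r s α β (+ n)))
              (sym (trans (cong (u ⊕_) (·-zeroʳ (+ n))) (⊕-identityʳ u)))
    where
    expand : ∀ p q α β n → p * (α * n) + q * (β * n) ≡ α * n + n * ((p - + 1) * α + q * β)
    expand = solve-∀
    expand′ : ∀ r s α β n → r * (α * n) + s * (β * n) ≡ β * n + n * (r * α + (s - + 1) * β)
    expand′ = solve-∀

  sl₂-trivial : ∀ p q r s w n → InDual (1 ∷ ds) (w , n) → _≈D_ (1 ∷ ds) (sl₂ p q r s w , n) (w , n)
  sl₂-trivial p q r s ((a , b) ∷ u) n w∈dual =
    shift⇒≈D {n = n} (sl₂-shift p q r s u (proj₁ (dual-head-divisible w∈dual)) (proj₂ (dual-head-divisible w∈dual)))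

  module _ {p q r s : ℤ} (det : p * s - q * r ≡ + 1) where

    private
      unimodular : ∀ x → (p * s - q * r) * x ≡ x
      unimodular x = trans (cong (_* x) det) (ℤP.*-identityˡ x)

    sl₂-preserves : ∀ u w → ⟪ sl₂ p q r s u , sl₂ p q r s w ⟫ ≡ ⟪ u , w ⟫
    sl₂-preserves ((a , b) ∷ u) ((a′ , b′) ∷ w) =
      cong (λ t → + 1 * t + form ds u w) (trans (expand p q r s a b a′ b′) (unimodular (a * b′ - b * a′)))
      where
      expand : ∀ p q r s a b a′ b′ →
        (p * a + q * b) * (r * a′ + s * b′) - (r * a + s * b) * (p * a′ + q * b′) ≡ (p * s - q * r) * (a * b′ - b * a′)
      expand = solve-∀

    sl₂-inverseˡ : ∀ u → sl₂ s (- q) (- r) p (sl₂ p q r s u) ≡ u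
    sl₂-inverseˡ ((a , b) ∷ u) =
      cong (λ h → h ∷ u) (cong₂ _,_ (trans (expand₁ p q r s a b) (unimodular a)) (trans (expand₂ p q r s a b) (unimodular b)))
      where
      expand₁ : ∀ p q r s a b → s * (p * a + q * b) + - q * (r * a + s * b) ≡ (p * s - q * r) * a
      expand₁ = solve-∀
      expand₂ : ∀ p q r s a b → - r * (p * a + q * b) + p * (r * a + s * b) ≡ (p * s - q * r) * b
      expand₂ = solve-∀

    sl₂-inverseʳ : ∀ u → sl₂ p q r s (sl₂ s (- q) (- r) p u) ≡ u
    sl₂-inverseʳ ((a , b) ∷ u) =
      cong (λ h → h ∷ u) (cong₂ _,_ (trans (expand₁ p q r s a b) (unimodular a)) (trans (expand₂ p q r s a b) (unimodular b)))
      where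
      expand₁ : ∀ p q r s a b → p * (s * a + - q * b) + q * (- r * a + p * b) ≡ (p * s - q * r) * a
      expand₁ = solve-∀
      expand₂ : ∀ p q r s a b → r * (s * a + - q * b) + s * (- r * a + p * b) ≡ (p * s - q * r) * b
      expand₂ = solve-∀

    sl₂∈Γ : InΓ (1 ∷ ds) (sl₂ p q r s)
    sl₂∈Γ = sl₂-additive p q r s , (sl₂ s (- q) (- r) p , sl₂-inverseˡ , sl₂-inverseʳ) , sl₂-preserves , sl₂-trivial p q r s

  -- An SL₂(ℤ)-move on ⟨e₁ , f₁⟩ makes (e₁ , v) vanish; the Eichler transvection along f₁ built from the
  -- part z₀ of the partner outside ⟨e₁ , f₁⟩ then raises it to m.
  normalize : ∀ {v z m} → ⟪ z , v ⟫ ≡ + m → ∃[ γ ] (InΓ (1 ∷ ds) γ × ⟪ e₁ , γ v ⟫ ≡ + m)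
  normalize {(α , β) ∷ v₀} {(ζ₁ , ζ₂) ∷ z₀} {m} zv≡m with sl₂-clearing α β
  ... | p , q , r , s , det , kill =
    (λ u → eichler f₁ y η (sl₂ p q r s u)) , InΓ-∘ (eichler∈Γ η f₁⊥y) (sl₂∈Γ {p} {q} {r} {s} det) ,
    trans (eichler-form f₁ y η e₁ (sl₂ p q r s ((α , β) ∷ v₀)))
          (collect (e₁-pairing G R v₀) (f₁-pairing G R v₀) (e₁-pairing (+ 0) (+ 0) z₀) (tail-pairing z₀ G R v₀) e₁f₁≡1 kill Az·Av)
    where
    y : L (suc g)
    y = (+ 0 , + 0) ∷ z₀

    ζ η G R : ℤ
    ζ = p * ζ₁ + q * ζ₂
    η = r * ζ₁ + s * ζ₂
    G = p * α + q * β
    R = r * α + s * β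

    f₁⊥y : ⟪ f₁ , y ⟫ ≡ + 0
    f₁⊥y = f₁-pairing (+ 0) (+ 0) z₀

    Az·Av : ζ * R - η * G + form ds z₀ v₀ ≡ + m
    Az·Av = trans (sym (head-form ζ η G R z₀ v₀)) (trans (sl₂-preserves {p} {q} {r} {s} det ((ζ₁ , ζ₂) ∷ z₀) ((α , β) ∷ v₀)) zv≡m)

    collect : ∀ {E₁ F₁ E₁y Yv E₁f R G Z₀ M} → E₁ ≡ R → F₁ ≡ - G → E₁y ≡ + 0 → Yv ≡ Z₀ → E₁f ≡ + 1
      → R ≡ + 0 → ζ * R - η * G + Z₀ ≡ M → E₁ + F₁ * E₁y + (Yv + η * F₁) * E₁f ≡ M
    collect {G = G} {Z₀} refl refl refl refl refl refl refl = expand ζ η G Z₀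
      where
      expand : ∀ ζ η G Z₀ → + 0 + - G * + 0 + (Z₀ + η * - G) * + 1 ≡ ζ * + 0 - η * G + Z₀
      expand = solve-∀

  partner-flip : ∀ {v z k} → ⟪ v , z ⟫ ≡ k → ⟪ -1ℤ · z , v ⟫ ≡ k
  partner-flip {v} {z} {k} vz≡k = begin
    ⟪ -1ℤ · z , v ⟫    ≡⟨ form-·ˡ (1 ∷ ds) -1ℤ z v ⟩
    -1ℤ * ⟪ z , v ⟫    ≡⟨ ℤP.-1*i≡-i ⟪ z , v ⟫ ⟩
    - ⟪ z , v ⟫        ≡⟨ cong -_ (form-antisym (1 ∷ ds) z v) ⟩
    - - ⟪ v , z ⟫      ≡⟨ ℤP.neg-involutive ⟪ v , z ⟫ ⟩
    ⟪ v , z ⟫          ≡⟨ vz≡k ⟩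
    k                  ∎

  Γ-transitive-same : ∀ {v w m} → IsDiv (1 ∷ ds) v m → IsDiv (1 ∷ ds) w m
    → _≈D_ (1 ∷ ds) (v , m) (w , m) → ∃[ γ ] (InΓ (1 ∷ ds) γ × γ v ≡ w)
  Γ-transitive-same {v} {w} {m} (m≥1 , v-div , z , vz≡m) (_ , w-div , z′ , wz′≡m) v≈w =
    compose (normalize {v} { -1ℤ · z } {m} (partner-flip {v} {z} vz≡m)) (normalize {w} { -1ℤ · z′ } {m} (partner-flip {w} {z′} wz′≡m))
    where
    compose : ∃[ γ ] (InΓ (1 ∷ ds) γ × ⟪ e₁ , γ v ⟫ ≡ + m) → ∃[ γ ] (InΓ (1 ∷ ds) γ × ⟪ e₁ , γ w ⟫ ≡ + m)
      → ∃[ γ ] (InΓ (1 ∷ ds) γ × γ v ≡ w)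
    compose (γ₁ , γ₁∈Γ@(_ , _ , _ , trivial₁) , e₁γ₁v≡m) (γ₂ , γ₂∈Γ@(_ , _ , _ , trivial₂) , e₁γ₂w≡m) =
      finish (InΓ-inverse γ₂∈Γ) (normal-forms-conjugate {e₁} {γ₁ v} {γ₂ w} {m} m≥1 γ₁v-div e₁γ₁v≡m e₁γ₂w≡m γ₂w≈γ₁v)
      where
      γ₁v-div : ∀ t → + m ∣ ⟪ γ₁ v , t ⟫
      γ₁v-div t = ∣ᵤ⇒∣ (proj₂ (InΓ-preserves-dual γ₁∈Γ (m≥1 , v-div)) t)
      γ₂w≈γ₁v : _≈D_ (1 ∷ ds) (γ₂ w , m) (γ₁ v , m)
      γ₂w≈γ₁v = ≈D-trans {γ₂ w} {w} {γ₁ v} {m} (trivial₂ w m (m≥1 , w-div))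
                  (≈D-trans {w} {v} {γ₁ v} {m} (≈D-sym {v} {w} {m} {m} v≈w) (≈D-sym {γ₁ v} {v} {m} {m} (trivial₁ v m (m≥1 , v-div))))
      finish : ∃[ δ ] (InΓ (1 ∷ ds) δ × (∀ u → δ (γ₂ u) ≡ u) × (∀ u → γ₂ (δ u) ≡ u))
        → ∃[ γ ] (InΓ (1 ∷ ds) γ × γ (γ₁ v) ≡ γ₂ w) → ∃[ γ ] (InΓ (1 ∷ ds) γ × γ v ≡ w)
      finish (δ₂ , δ₂∈Γ , δ₂γ₂ , _) (γ₃ , γ₃∈Γ , γ₃γ₁v≡γ₂w) =
        (λ u → δ₂ (γ₃ (γ₁ u))) , InΓ-∘ δ₂∈Γ (InΓ-∘ γ₃∈Γ γ₁∈Γ) , trans (cong δ₂ γ₃γ₁v≡γ₂w) (δ₂γ₂ w)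

  Γ-transitive : ∀ {v w m m′} → Primitive (1 ∷ ds) v → Primitive (1 ∷ ds) w → IsDiv (1 ∷ ds) v m → IsDiv (1 ∷ ds) w m′
    → _≈D_ (1 ∷ ds) (v , m) (w , m′) → ∃[ γ ] (InΓ (1 ∷ ds) γ × γ v ≡ w)
  Γ-transitive {v} {w} {m} {m′} prim-v prim-w v-isDiv@(m≥1 , _) w-isDiv@(m′≥1 , _) v≈w =
    Γ-transitive-same v-isDiv (subst (IsDiv (1 ∷ ds) w) (sym m≡m′) w-isDiv) (subst (λ k → _≈D_ (1 ∷ ds) (v , m) (w , k)) (sym m≡m′) v≈w)
    where
    m≡m′ : m ≡ m′
    m≡m′ = ≈D⇒same-div {v} {w} {m} {m′} prim-v prim-w m≥1 m′≥1 v≈w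

theorem3p2 : ∀ (h : ℕ) (d : Vec ℕ (suc (suc h)))
  → IsType d → lookup d zero ≡ 1 → lookup d (suc zero) ≡ 1
  -- v splitting ⇔ [v*] splitting  (m = div v, v* = v / m)
  → (∀ v m → Primitive d v → IsDiv d v m
       → (Splitting d v → SplittingD d (v , m)) × (SplittingD d (v , m) → Splitting d v))
  -- Γ_Λ preserves the set of splitting vectors
  × (∀ γ → InΓ d γ → ∀ v → Splitting d v → Splitting d (γ v))
  -- v ↦ [v*] is constant on Γ_Λ-orbits
  × (∀ γ → InΓ d γ → ∀ v m m' → Splitting d v → IsDiv d v m → IsDiv d (γ v) m'
       → _≈D_ d (γ v , m') (v , m))
  -- injective on orbits
  × (∀ v w m m' → Splitting d v → Splitting d w → IsDiv d v m → IsDiv d w m'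
       → _≈D_ d (v , m) (w , m') → ∃[ γ ] (InΓ d γ × γ v ≡ w))
  -- surjective onto splitting elements of D_Λ
  × (∀ x → InDual d x → SplittingD d x
       → ∃[ v ] ∃[ m ] (Splitting d v × IsDiv d v m × _≈D_ d (v , m) x))
theorem3p2 _ (d₁ ∷ ds) _ refl _ =
  (λ v m prim v-isDiv → (λ v-split → splitting⇒splittingD v-split v-isDiv) , splittingD⇒splitting prim v-isDiv) ,
  (λ γ γ∈Γ v → InΓ-preserves-splitting γ∈Γ) ,
  (λ γ γ∈Γ v m m′ _ → InΓ-fixes-class {γ} {v} γ∈Γ) ,
  (λ v w m m′ v-split w-split → Γ-transitive (proj₁ v-split) (proj₁ w-split)) ,
  (λ x → splittingD⇒realised {e₁} {f₁} e₁f₁≡1 {proj₁ x} {proj₂ x})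
  where
  open Lattice (1 ∷ ds)
  open UnimodularHead ds
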